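{- For every $n\ge 1$, $$\sum_{\sigma\in\mathcal{Q}_n}x^{\mathrm{lap}(\sigma)}y^{\mathrm{dasc}(\sigma)}z^{\mathrm{dp}(\sigma)}=\sum_{\substack{1\le i\le n\\ 0\le j\le n-1}}\gamma_{n,i,j}\,x^i(y+z)^j,$$ where $\gamma_{n,i,j}=\#\{\sigma\in\mathcal{Q}_n:\mathrm{lap}(\sigma)=i,\ \mathrm{dasc}(\sigma)=j,\ \mathrm{dp}(\sigma)=0\}$.
   Context: A Stirling permutation of order $n$ is a permutation $\sigma=\sigma_1\cdots\sigma_{2n}$ of the multiset $\{1,1,2,2,\ldots,n,n\}$ such that for each $i$, all entries between the two occurrences of $i$ are larger than $i$; $\mathcal{Q}_n$ is the set of these. Set $\sigma_0=0$. For $1\le i\le 2n-1$: $i$ is a left ascent-plateau if $\sigma_{i-1}<\sigma_i=\sigma_{i+1}$; a double ascent if $\sigma_{i-1}<\sigma_i<\sigma_{i+1}$; a descent-plateau if $\sigma_{i-1}>\sigma_i=\sigma_{i+1}$. $\mathrm{lap}(\sigma)$, $\mathrm{dasc}(\sigma)$, $\mathrm{dp}(\sigma)$ denote the numbers of left ascent-plateaus, double ascents and descent-plateaus. -}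

module Defs where

open import Data.Nat using (ℕ; zero; suc; _+_; _*_; _∸_; _^_; _<ᵇ_; _≡ᵇ_)
open import Data.Bool using (Bool; true; false; _∧_; _∨_; not; if_then_else_)
open import Data.List using (List; []; _∷_; map; filter; length; concatMap; upTo; applyUpTo)
open import Data.Nat.ListAction using (sum)
open import Data.List.Base using (lookup)
import Data.Bool.Properties
open import Relation.Nullary.Decidable using (does)
open import Relation.Binary.PropositionalEquality using (_≡_)
open import Data.Bool using (T)

all : {A : Set} → (A → Bool) → List A → Bool
all p [] = true
all p (x ∷ xs) = p x ∧ all p xs

range1 : ℕ → List ℕ
range1 n = applyUpTo suc n

words : ℕ → ℕ → List (List ℕ)
words zero    n = [] ∷ []
words (suc m) n = concatMap (λ a → map (a ∷_) (words m n)) (range1 n)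

-- entry at 0-based position p (0 if out of range)
at : List ℕ → ℕ → ℕ
at []       _       = 0
at (x ∷ xs) zero    = x
at (x ∷ xs) (suc p) = at xs p

occ : ℕ → List ℕ → ℕ
occ a [] = 0
occ a (x ∷ xs) = (if a ≡ᵇ x then 1 else 0) + occ a xs

-- w is a permutation of the multiset {1,1,2,2,…,n,n}  (given w has entries in 1..n, length 2n)
isMultiset : ℕ → List ℕ → Bool
isMultiset n w = all (λ i → occ i w ≡ᵇ 2) (range1 n)

idx : ℕ → List ℕ
idx k = upTo k

stirlingCond : List ℕ → Bool
stirlingCond w =
  all (λ a → all (λ b → all (λ c →
      not ((a <ᵇ b) ∧ (b <ᵇ c) ∧ (at w a ≡ᵇ at w c)) ∨ (at w a <ᵇ at w b))
    (idx (length w))) (idx (length w))) (idx (length w))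

Q : ℕ → List (List ℕ)
Q n = filter (λ w → Data.Bool.Properties.T? (isMultiset n w ∧ stirlingCond w)) (words (2 * n) n)

-- Statistics.  With σ = σ₁⋯σ_{2n} and σ₀ = 0, let s = 0 ∷ σ, so s at position i is σ_i.
-- For 1 ≤ i ≤ 2n-1 examine (σ_{i-1}, σ_i, σ_{i+1}).
countPos : (ℕ → ℕ → ℕ → Bool) → List ℕ → ℕ
countPos P σ = length (filter (λ i → Data.Bool.Properties.T? (P (at s (i ∸ 1)) (at s i) (at s (suc i))))
                              (range1 (length σ ∸ 1)))
  where s = 0 ∷ σ

lap : List ℕ → ℕ
lap = countPos (λ a b c → (a <ᵇ b) ∧ (b ≡ᵇ c))

dasc : List ℕ → ℕ
dasc = countPos (λ a b c → (a <ᵇ b) ∧ (b <ᵇ c))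

dp : List ℕ → ℕ
dp = countPos (λ a b c → (b <ᵇ a) ∧ (b ≡ᵇ c))

lhs : ℕ → ℕ → ℕ → ℕ → ℕ
lhs n x y z = sum (map (λ σ → x ^ lap σ * y ^ dasc σ * z ^ dp σ) (Q n))

γ : ℕ → ℕ → ℕ → ℕ
γ n i j = length (filter (λ σ → Data.Bool.Properties.T?
              ((lap σ ≡ᵇ i) ∧ (dasc σ ≡ᵇ j) ∧ (dp σ ≡ᵇ 0))) (Q n))

rhs : ℕ → ℕ → ℕ → ℕ → ℕ
rhs n x y z = sum (map (λ i → sum (map (λ j → γ n i j * x ^ i * (y + z) ^ j) (upTo n))) (range1 n))

module Submission where

-- Fix i = lap and j = dasc + dp, and let K b count the σ ∈ 𝒬ₙ of this kind
-- with dp σ = b, so that K 0 = γ n i j.  In a Stirling permutation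
-- X · B · v v · Y, with B the maximal block of entries > v before the plateau,
-- moving the first v in front of B gives X · v B v · Y: again Stirling, with
-- the same lap, one double ascent more and one descent-plateau less; and every
-- double ascent arises in this way.  Double counting these occurrences gives
-- (b+1) · K(b+1) = (j−b) · K b, hence K b = C(j,b) · γ, and the binomial
-- theorem collects the terms x^i y^(j−b) z^b into γ x^i (y+z)^j.  The ranges of
-- the right-hand side come from lap + dasc + dp ≤ n and lap ≥ 1.

open import Defs
open import Data.Nat using (ℕ; zero; suc; _+_; _*_; _∸_; _^_; _≤_; _<_; _≥_; z≤n; s≤s; _<ᵇ_; _≡ᵇ_; _≟_; _<?_)
open import Data.Nat.Properties
open import Data.Nat.ListAction using (sum)
open import Data.Nat.ListAction.Properties using (sum-++)
open import Data.Nat.Tactic.RingSolver using (solve-∀)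
open import Data.Bool using (Bool; true; false; _∧_; _∨_; not; if_then_else_; T)
open import Data.Bool.Properties using (T?; T-≡; ∧-zeroʳ; ∧-assoc)
open import Data.List using (List; []; _∷_; _++_; map; filter; length; concatMap; upTo; applyUpTo; take; drop; [_])
open import Data.List.Properties using (length-++; ++-assoc; length-map; map-++; map-applyUpTo; upTo-∷ʳ; length-applyUpTo)
open import Data.List.Membership.Propositional using (_∈_; _∉_; find)
open import Data.List.Membership.Propositional.Properties
  using (∈-upTo⁺; ∈-upTo⁻; ∈-++⁺ʳ; ∈-concatMap⁺; ∈-concatMap⁻; ∈-map⁺; ∈-map⁻; ∈-filter⁺; ∈-filter⁻; ∈-applyUpTo⁺; ∈-applyUpTo⁻; ∈-∃++)
open import Data.List.Membership.DecPropositional _≟_ using (_∈?_)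
open import Data.List.Relation.Unary.Any using (Any; here; there)
import Data.List.Relation.Unary.Any as Any
open import Data.List.Relation.Unary.All using (All; []; _∷_)
open import Data.List.Relation.Unary.All.Properties using () renaming (map⁺ to All-map⁺)
import Data.List.Relation.Unary.All as All
open import Data.List.Relation.Unary.AllPairs using ([]; _∷_)
open import Data.List.Relation.Unary.Unique.Propositional using (Unique)
open import Data.List.Relation.Unary.Unique.Propositional.Properties using (++⁺; map⁺; filter⁺; applyUpTo⁺₁)
open import Data.List.Relation.Binary.Permutation.Propositional as ↭ using (_↭_; ↭-sym)
open import Data.List.Relation.Binary.Permutation.Propositional.Properties using (↭-length; All-resp-↭; shift; ++⁺ˡ)
open import Data.Product using (Σ; _×_; _,_; proj₁; proj₂)
open import Data.Empty using (⊥; ⊥-elim)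
open import Data.Unit using (⊤; tt)
open import Function using (case_of_)
open import Function.Bundles using (Equivalence)
open import Relation.Binary.PropositionalEquality hiding ([_])
open import Relation.Nullary using (¬_; yes; no)

-- The Boolean tests used in Defs, reflected into propositions in the
-- "≡ true / ≡ false" form that 'rewrite' can use to evaluate them.

T⇒true : ∀ {b} → T b → b ≡ true
T⇒true = Equivalence.to T-≡

true⇒T : ∀ {b} → b ≡ true → T b
true⇒T = Equivalence.from T-≡

<ᵇ-true : ∀ {m n} → m < n → (m <ᵇ n) ≡ true
<ᵇ-true p = T⇒true (<⇒<ᵇ p)

<ᵇ-false : ∀ {m n} → ¬ (m < n) → (m <ᵇ n) ≡ false
<ᵇ-false {m} {n} m≮n with m <ᵇ n in eq
... | true  = ⊥-elim (m≮n (<ᵇ⇒< m n (true⇒T eq)))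
... | false = refl

<ᵇ-false⇒≮ : ∀ {m n} → (m <ᵇ n) ≡ false → ¬ (m < n)
<ᵇ-false⇒≮ e lt with () ← trans (sym (<ᵇ-true lt)) e

<ᵇ-sound : ∀ {m n} → (m <ᵇ n) ≡ true → m < n
<ᵇ-sound {m} {n} e = <ᵇ⇒< m n (true⇒T e)

≡ᵇ-true : ∀ {m n} → m ≡ n → (m ≡ᵇ n) ≡ true
≡ᵇ-true {m} {n} e = T⇒true (≡⇒≡ᵇ m n e)

≡ᵇ-false : ∀ {m n} → m ≢ n → (m ≡ᵇ n) ≡ false
≡ᵇ-false {m} {n} m≢n with m ≡ᵇ n in eq
... | true  = ⊥-elim (m≢n (≡ᵇ⇒≡ m n (true⇒T eq)))
... | false = refl

≡ᵇ-false⇒≢ : ∀ {m n} → (m ≡ᵇ n) ≡ false → m ≢ n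
≡ᵇ-false⇒≢ e m≡n with () ← trans (sym (≡ᵇ-true m≡n)) e

≡ᵇ-sound : ∀ {m n} → (m ≡ᵇ n) ≡ true → m ≡ n
≡ᵇ-sound {m} {n} e = ≡ᵇ⇒≡ m n (true⇒T e)

∧-true₁ : ∀ {a b} → (a ∧ b) ≡ true → a ≡ true
∧-true₁ {true} _ = refl

∧-true₂ : ∀ {a b} → (a ∧ b) ≡ true → b ≡ true
∧-true₂ {true} e = e

all-elim : ∀ {A : Set} (p : A → Bool) (L : List A) → all p L ≡ true → ∀ {x} → x ∈ L → p x ≡ true
all-elim p (y ∷ L) e (here refl) = ∧-true₁ e
all-elim p (y ∷ L) e (there m)   = all-elim p L (∧-true₂ {p y} e) m

all-intro : ∀ {A : Set} (p : A → Bool) (L : List A) → (∀ {x} → x ∈ L → p x ≡ true) → all p L ≡ true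
all-intro p []      h = refl
all-intro p (y ∷ L) h rewrite h (here refl) = all-intro p L (λ m → h (there m))

all-cong : ∀ {A : Set} (p q : A → Bool) (L : List A) → (∀ x → p x ≡ q x) → all p L ≡ all q L
all-cong p q []      h = refl
all-cong p q (y ∷ L) h rewrite h y | all-cong p q L h = refl

cong₃ : ∀ (f : ℕ → ℕ → ℕ → ℕ) {a a' c c' d d'} → a ≡ a' → c ≡ c' → d ≡ d' → f a c d ≡ f a' c' d'
cong₃ f refl refl refl = refl

at-∈ : ∀ (w : List ℕ) i → i < length w → at w i ∈ w
at-∈ (x ∷ w) zero    _       = here refl
at-∈ (x ∷ w) (suc i) (s≤s p) = there (at-∈ w i p)

∈-at : ∀ {x} (w : List ℕ) → x ∈ w → Σ ℕ λ i → i < length w × at w i ≡ x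
∈-at (y ∷ w) (here refl) = zero , s≤s z≤n , refl
∈-at (y ∷ w) (there m) with ∈-at w m
... | i , lt , e = suc i , s≤s lt , e

at-middle : ∀ X (v : ℕ) C → at (X ++ v ∷ C) (length X) ≡ v
at-middle []      v C = refl
at-middle (x ∷ X) v C = at-middle X v C

at-middle₂ : ∀ X (v w : ℕ) C → at (X ++ v ∷ w ∷ C) (suc (length X)) ≡ w
at-middle₂ []      v w C = refl
at-middle₂ (x ∷ X) v w C = at-middle₂ X v w C

split-at₂ : ∀ (w : List ℕ) i → suc i < length w → w ≡ take i w ++ at w i ∷ at w (suc i) ∷ drop (suc (suc i)) w
split-at₂ (x ∷ y ∷ w) zero    _       = refl
split-at₂ (x ∷ w)     (suc i) (s≤s lt) = cong (x ∷_) (split-at₂ w i lt)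

length-take-≤ : ∀ (w : List ℕ) i → i ≤ length w → length (take i w) ≡ i
length-take-≤ w       zero    _        = refl
length-take-≤ (x ∷ w) (suc i) (s≤s le) = cong suc (length-take-≤ w i le)

take-++ : ∀ (X C : List ℕ) → take (length X) (X ++ C) ≡ X
take-++ []      C = refl
take-++ (x ∷ X) C = cong (x ∷_) (take-++ X C)

drop-++₁ : ∀ X (v : ℕ) C → drop (suc (length X)) (X ++ v ∷ C) ≡ C
drop-++₁ []      v C = refl
drop-++₁ (x ∷ X) v C = drop-++₁ X v C

drop-++₂ : ∀ X (v w : ℕ) C → drop (suc (suc (length X))) (X ++ v ∷ w ∷ C) ≡ C
drop-++₂ []      v w C = refl
drop-++₂ (x ∷ X) v w C = drop-++₂ X v w C

lastOr : ℕ → List ℕ → ℕ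
lastOr p []      = p
lastOr p (x ∷ X) = lastOr x X

headOr : ℕ → List ℕ → ℕ
headOr c []      = c
headOr c (x ∷ X) = x

lastOr-∈ : ∀ d x X → lastOr d (x ∷ X) ∈ (x ∷ X)
lastOr-∈ d x []      = here refl
lastOr-∈ d x (y ∷ X) = there (lastOr-∈ d y X)

lastOr-++ : ∀ d X b B → lastOr d (X ++ b ∷ B) ≡ lastOr b B
lastOr-++ d []      b B = refl
lastOr-++ d (x ∷ X) b B = lastOr-++ x X b B

at-before : ∀ d (w : List ℕ) i → i ≤ length w → at (d ∷ w) i ≡ lastOr d (take i w)
at-before d w       zero    _        = refl
at-before d (x ∷ w) (suc i) (s≤s le) = at-before x w i le

at-before-++ : ∀ d X C → at (d ∷ X ++ C) (length X) ≡ lastOr d X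
at-before-++ d []      C = refl
at-before-++ d (x ∷ X) C = at-before-++ x X C

All-last : ∀ {P : ℕ → Set} d y X → All P (y ∷ X) → P (lastOr d (y ∷ X))
All-last d y []      (p ∷ _)  = p
All-last d y (z ∷ X) (_ ∷ ps) = All-last d z X ps

All<⇒∉ : ∀ v B → All (v <_) B → v ∉ B
All<⇒∉ v (b ∷ B) (p ∷ ps) (here refl) = <-irrefl refl p
All<⇒∉ v (b ∷ B) (p ∷ ps) (there m)   = All<⇒∉ v B ps m

∈-insert : ∀ {z : ℕ} A {W} y → z ∈ A ++ W → z ∈ A ++ y ∷ W
∈-insert []      y m         = there m
∈-insert (a ∷ A) y (here e)  = here e
∈-insert (a ∷ A) y (there m) = there (∈-insert A y m)

∈-dedup : ∀ {z : ℕ} A v {Y} → z ∈ A ++ v ∷ v ∷ Y → z ∈ A ++ v ∷ Y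
∈-dedup []      v (here e)  = here e
∈-dedup []      v (there m) = m
∈-dedup (a ∷ A) v (here e)  = here e
∈-dedup (a ∷ A) v (there m) = there (∈-dedup A v m)

∈-++-mono : ∀ {z : ℕ} A {C C'} → (z ∈ C' → z ∈ C) → z ∈ A ++ C' → z ∈ A ++ C
∈-++-mono []      f m         = f m
∈-++-mono (a ∷ A) f (here e)  = here e
∈-++-mono (a ∷ A) f (there m) = there (∈-++-mono A f m)

occ-++ : ∀ a X C → occ a (X ++ C) ≡ occ a X + occ a C
occ-++ a []      C = refl
occ-++ a (x ∷ X) C = trans (cong (δ +_) (occ-++ a X C)) (sym (+-assoc δ (occ a X) (occ a C)))
  where δ = if a ≡ᵇ x then 1 else 0

occ-∉ : ∀ a X → a ∉ X → occ a X ≡ 0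
occ-∉ a []      _ = refl
occ-∉ a (x ∷ X) n rewrite ≡ᵇ-false {a} {x} (λ e → n (here e)) = occ-∉ a X (λ m → n (there m))

occ-∈ : ∀ a R → occ a R ≢ 0 → a ∈ R
occ-∈ a []      h = ⊥-elim (h refl)
occ-∈ a (x ∷ R) h with a ≡ᵇ x in e
... | true  = here (≡ᵇ-sound e)
... | false = there (occ-∈ a R h)

occ-self : ∀ a R → occ a (a ∷ R) ≡ suc (occ a R)
occ-self a R rewrite ≡ᵇ-true {a} {a} refl = refl

occ-↭ : ∀ a {σ σ'} → σ ↭ σ' → occ a σ ≡ occ a σ'
occ-↭ a ↭.refl          = refl
occ-↭ a (↭.prep x p)    = cong (_ +_) (occ-↭ a p)
occ-↭ a {x ∷ y ∷ xs} {_ ∷ _ ∷ ys} (↭.swap x y p) = begin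
  δx + (δy + occ a xs)  ≡⟨ sym (+-assoc δx δy _) ⟩
  (δx + δy) + occ a xs  ≡⟨ cong₂ _+_ (+-comm δx δy) (occ-↭ a p) ⟩
  (δy + δx) + occ a ys  ≡⟨ +-assoc δy δx _ ⟩
  δy + (δx + occ a ys)  ∎
  where
  open ≡-Reasoning
  δx : ℕ
  δx = if a ≡ᵇ x then 1 else 0
  δy : ℕ
  δy = if a ≡ᵇ y then 1 else 0
occ-↭ a (↭.trans p q)   = trans (occ-↭ a p) (occ-↭ a q)

∈-range1-pos : ∀ {a n} → a ∈ range1 n → 0 < a
∈-range1-pos m with ∈-applyUpTo⁻ suc m
... | i , _ , refl = s≤s z≤n

∈-range1-≤ : ∀ {a n} → a ∈ range1 n → a ≤ n
∈-range1-≤ m with ∈-applyUpTo⁻ suc m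
... | i , lt , refl = lt

Guards : ℕ → List ℕ → Set
Guards x []      = ⊤
Guards x (y ∷ w) = (x ∈ w → x < y) × Guards x w

Stirling : List ℕ → Set
Stirling []      = ⊤
Stirling (y ∷ w) = Guards y w × Stirling w

-- The positional form, which is what 'stirlingCond' tests.
StirlingAt : List ℕ → Set
StirlingAt w = ∀ a b c → a < b → b < c → c < length w → at w a ≡ at w c → at w a < at w b

GuardsAt : ℕ → List ℕ → Set
GuardsAt x w = ∀ b c → b < c → c < length w → at w c ≡ x → x < at w b

Guards⇒GuardsAt : ∀ x w → Guards x w → GuardsAt x w
Guards⇒GuardsAt x (y ∷ w) (h , hw) zero    (suc c) bc       (s≤s cl) e = h (subst (_∈ w) e (at-∈ w c cl))
Guards⇒GuardsAt x (y ∷ w) (h , hw) (suc b) (suc c) (s≤s bc) (s≤s cl) e = Guards⇒GuardsAt x w hw b c bc cl e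

GuardsAt⇒Guards : ∀ x w → GuardsAt x w → Guards x w
GuardsAt⇒Guards x []      h = tt
GuardsAt⇒Guards x (y ∷ w) h =
    (λ m → let (i , lt , e) = ∈-at w m in h zero (suc i) (s≤s z≤n) (s≤s lt) e)
  , GuardsAt⇒Guards x w (λ b c bc cl e → h (suc b) (suc c) (s≤s bc) (s≤s cl) e)

Stirling⇒StirlingAt : ∀ w → Stirling w → StirlingAt w
Stirling⇒StirlingAt (y ∷ w) (h , s) zero (suc b) (suc c) _ (s≤s bc) (s≤s cl) e =
  Guards⇒GuardsAt y w h b c bc cl (sym e)
Stirling⇒StirlingAt (y ∷ w) (h , s) (suc a) (suc b) (suc c) (s≤s ab) (s≤s bc) (s≤s cl) e =
  Stirling⇒StirlingAt w s a b c ab bc cl e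

StirlingAt⇒Stirling : ∀ w → StirlingAt w → Stirling w
StirlingAt⇒Stirling []      h = tt
StirlingAt⇒Stirling (y ∷ w) h =
    GuardsAt⇒Guards y w (λ b c bc cl e → h zero (suc b) (suc c) (s≤s z≤n) (s≤s bc) (s≤s cl) (sym e))
  , StirlingAt⇒Stirling w (λ a b c ab bc cl e → h (suc a) (suc b) (suc c) (s≤s ab) (s≤s bc) (s≤s cl) e)

stirlingTest : List ℕ → ℕ → ℕ → ℕ → Bool
stirlingTest w a b c = not ((a <ᵇ b) ∧ (b <ᵇ c) ∧ (at w a ≡ᵇ at w c)) ∨ (at w a <ᵇ at w b)

stirlingCond⇒Stirling : ∀ w → stirlingCond w ≡ true → Stirling w
stirlingCond⇒Stirling w e = StirlingAt⇒Stirling w λ a b c ab bc cl eq →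
  test-sound a b c ab bc eq (test-holds a b c (<-trans ab (<-trans bc cl)) (<-trans bc cl) cl)
  where
  L : List ℕ
  L = idx (length w)
  test-holds : ∀ a b c → a < length w → b < length w → c < length w → stirlingTest w a b c ≡ true
  test-holds a b c al bl cl = all-elim _ L (all-elim _ L (all-elim _ L e (∈-upTo⁺ al)) (∈-upTo⁺ bl)) (∈-upTo⁺ cl)
  test-sound : ∀ a b c → a < b → b < c → at w a ≡ at w c → stirlingTest w a b c ≡ true → at w a < at w b
  test-sound a b c ab bc eq t rewrite <ᵇ-true ab | <ᵇ-true bc | ≡ᵇ-true eq = <ᵇ-sound t

Stirling⇒stirlingCond : ∀ w → Stirling w → stirlingCond w ≡ true
Stirling⇒stirlingCond w s =
  all-intro _ L λ {a} _ → all-intro _ L λ {b} _ → all-intro _ L λ {c} cm → test-complete a b c (∈-upTo⁻ cm)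
  where
  L : List ℕ
  L = idx (length w)
  test-complete : ∀ a b c → c < length w → stirlingTest w a b c ≡ true
  test-complete a b c cl with a <ᵇ b in e₁ | b <ᵇ c in e₂ | at w a ≡ᵇ at w c in e₃
  ... | true  | true  | true rewrite <ᵇ-true (Stirling⇒StirlingAt w s a b c (<ᵇ-sound e₁) (<ᵇ-sound e₂) cl (≡ᵇ-sound e₃)) = refl
  ... | false | _     | _     = refl
  ... | true  | false | _     = refl
  ... | true  | true  | false = refl

∉⇒Guards : ∀ x w → x ∉ w → Guards x w
∉⇒Guards x []      _ = tt
∉⇒Guards x (y ∷ w) n = (λ m → ⊥-elim (n (there m))) , ∉⇒Guards x w (λ m → n (there m))

Guards⇒All : ∀ x A C → Guards x (A ++ C) → x ∈ C → All (x <_) A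
Guards⇒All x []      C h       m = []
Guards⇒All x (a ∷ A) C (f , h) m = f (∈-++⁺ʳ A m) ∷ Guards⇒All x A C h m

Guards-at : ∀ x A y C → Guards x (A ++ y ∷ C) → x ∈ C → x < y
Guards-at x []      y C (f , h) m = f m
Guards-at x (a ∷ A) y C (f , h) m = Guards-at x A y C h m

Stirling-suffix : ∀ A C → Stirling (A ++ C) → Stirling C
Stirling-suffix []      C s       = s
Stirling-suffix (a ∷ A) C (h , s) = Stirling-suffix A C s

plateau-last : ∀ A v Y → Stirling (A ++ v ∷ v ∷ Y) → v ∉ Y
plateau-last A v Y s m = <-irrefl refl (proj₁ (proj₁ (Stirling-suffix A (v ∷ v ∷ Y) s)) m)

Guards-delete : ∀ x A y W → Guards x (A ++ y ∷ W) → Guards x (A ++ W)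
Guards-delete x []      y W (f , h) = h
Guards-delete x (a ∷ A) y W (f , h) = (λ m → f (∈-insert A y m)) , Guards-delete x A y W h

Stirling-delete : ∀ A y W → Stirling (A ++ y ∷ W) → Stirling (A ++ W)
Stirling-delete []      y W (h , s) = s
Stirling-delete (a ∷ A) y W (h , s) = Guards-delete a A y W h , Stirling-delete A y W s

Guards-duplicate : ∀ x A v Y → x ≢ v → Guards x (A ++ v ∷ Y) → Guards x (A ++ v ∷ v ∷ Y)
Guards-duplicate x []      v Y ne (f , h) = (λ { (here e) → ⊥-elim (ne e) ; (there m) → f m }) , f , h
Guards-duplicate x (a ∷ A) v Y ne (f , h) = (λ m → f (∈-dedup A v m)) , Guards-duplicate x A v Y ne h

Stirling-duplicate : ∀ A v Y → v ∉ A → v ∉ Y → Stirling (A ++ v ∷ Y) → Stirling (A ++ v ∷ v ∷ Y)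
Stirling-duplicate []      v Y nA nY (h , s) = ((λ m → ⊥-elim (nY m)) , h) , h , s
Stirling-duplicate (a ∷ A) v Y nA nY (h , s) =
    Guards-duplicate a A v Y (λ e → nA (here (sym e))) h
  , Stirling-duplicate A v Y (λ m → nA (there m)) nY s

Guards-replace : ∀ x A C C' → Guards x (A ++ C) → (x ∈ C' → x ∈ C) → (Guards x C → Guards x C') → Guards x (A ++ C')
Guards-replace x []      C C' h       c g = g h
Guards-replace x (a ∷ A) C C' (f , h) c g = (λ m → f (∈-++-mono A c m)) , Guards-replace x A C C' h c g

Stirling-replace-suffix : ∀ X M M' → Stirling (X ++ M) → (∀ {x} → x ∈ X → Guards x M → Guards x M')
                        → (∀ {z} → z ∈ M' → z ∈ M) → Stirling M' → Stirling (X ++ M')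
Stirling-replace-suffix []      M M' s       t c s' = s'
Stirling-replace-suffix (x ∷ X) M M' (h , s) t c s' =
    Guards-replace x X M M' h c (t (here refl))
  , Stirling-replace-suffix X M M' s (λ m → t (there m)) c s'

-- If X ++ M is Stirling and X ends below v, then every value shared by X
-- and M is below v (it is guarded by the last entry of X).
shared-below : ∀ X M v → Stirling (X ++ M) → lastOr 0 X < v → ∀ {x} → x ∈ X → x ∈ M → x < v
shared-below (x ∷ [])    M v s       lt (here refl) m = lt
shared-below (x ∷ y ∷ X) M v (h , s) lt (here refl) m =
  <-trans (All-last x y X (Guards⇒All x (y ∷ X) M h m)) lt
shared-below (x ∷ y ∷ X) M v (h , s) lt (there xm) m = shared-below (y ∷ X) M v s lt xm m

plateau-not-in-prefix : ∀ X A v Y → v ∈ X → Stirling (X ++ A ++ v ∷ v ∷ Y) → ⊥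
plateau-not-in-prefix (x ∷ X) A v Y (here refl) (h , s) =
  <-irrefl refl (Guards-at v (X ++ A) v (v ∷ Y) (subst (Guards v) (sym (++-assoc X A (v ∷ v ∷ Y))) h) (here refl))
plateau-not-in-prefix (x ∷ X) A v Y (there m) (h , s) = plateau-not-in-prefix X A v Y m s

Guards-surround : ∀ v B Y → All (v <_) B → v ∉ Y → Guards v (B ++ v ∷ Y)
Guards-surround v []      Y []       nY = (λ m → ⊥-elim (nY m)) , ∉⇒Guards v Y nY
Guards-surround v (b ∷ B) Y (p ∷ ps) nY = (λ _ → p) , Guards-surround v B Y ps nY

∈-move-to : ∀ {z : ℕ} B v Y → z ∈ v ∷ B ++ v ∷ Y → z ∈ B ++ v ∷ v ∷ Y
∈-move-to B v Y (here e)  = ∈-++⁺ʳ B (here e)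
∈-move-to B v Y (there m) = ∈-insert B v m

∈-move-from : ∀ {z : ℕ} B v Y → z ∈ B ++ v ∷ v ∷ Y → z ∈ v ∷ B ++ v ∷ Y
∈-move-from B v Y m = there (∈-dedup B v m)

Stirling-move : ∀ X B v Y → Stirling (X ++ B ++ v ∷ v ∷ Y) → All (v <_) B → lastOr 0 X < v
              → Stirling (X ++ v ∷ B ++ v ∷ Y)
Stirling-move X B v Y s allB lt =
  Stirling-replace-suffix X M M' s still-guards (∈-move-to B v Y)
    (Guards-surround v B Y allB (plateau-last B v Y sM) , Stirling-delete B v (v ∷ Y) sM)
  where
  M : List ℕ
  M = B ++ v ∷ v ∷ Y
  M' : List ℕ
  M' = v ∷ B ++ v ∷ Y
  sM : Stirling M
  sM = Stirling-suffix X M s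
  still-guards : ∀ {x} → x ∈ X → Guards x M → Guards x M'
  still-guards xm h = (λ m → shared-below X M v s lt xm (∈-move-to B v Y (there m))) , Guards-delete _ B v (v ∷ Y) h

Stirling-unmove : ∀ X B v Y → Stirling (X ++ v ∷ B ++ v ∷ Y) → lastOr 0 X < v
                → Stirling (X ++ B ++ v ∷ v ∷ Y) × All (v <_) B × v ∉ Y
Stirling-unmove X B v Y s lt =
    Stirling-replace-suffix X M' M s still-guards (∈-move-from B v Y)
      (Stirling-duplicate B v Y (All<⇒∉ v B allB) nY (proj₂ sM'))
  , allB , nY
  where
  M : List ℕ
  M = B ++ v ∷ v ∷ Y
  M' : List ℕ
  M' = v ∷ B ++ v ∷ Y
  sM' : Stirling M'
  sM' = Stirling-suffix X M' s
  allB : All (v <_) B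
  allB = Guards⇒All v B (v ∷ Y) (proj₁ sM') (here refl)
  nY : v ∉ Y
  nY m = <-irrefl refl (Guards-at v B v Y (proj₁ sM') m)
  still-guards : ∀ {x} → x ∈ X → Guards x M' → Guards x M
  still-guards {x} xm (_ , h) =
    Guards-duplicate x B v Y (λ e → <-irrefl e (shared-below X M' v s lt xm (subst (_∈ M') (sym e) (here refl)))) h

words-sound : ∀ m n w → w ∈ words m n → length w ≡ m × All (_∈ range1 n) w
words-sound zero    n []      (here refl) = refl , []
words-sound zero    n (x ∷ w) (here ())
words-sound zero    n w       (there ())
words-sound (suc m) n w mem with find (∈-concatMap⁻ (λ a → map (a ∷_) (words m n)) {xs = range1 n} mem)
... | a , am , wm with ∈-map⁻ (a ∷_) wm
... | w' , w'm , refl with words-sound m n w' w'm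
... | l , al = cong suc l , am ∷ al

words-complete : ∀ m n w → length w ≡ m → All (_∈ range1 n) w → w ∈ words m n
words-complete zero    n []      _ _         = here refl
words-complete (suc m) n (x ∷ w) l (xm ∷ al) =
  ∈-concatMap⁺ (λ a → map (a ∷_) (words m n)) {xs = range1 n}
    (Any.map (λ { refl → ∈-map⁺ (x ∷_) (words-complete m n w (suc-injective l) al) }) xm)

range1-unique : ∀ n → Unique (range1 n)
range1-unique n = applyUpTo⁺₁ suc n (λ i<j _ e → <-irrefl (suc-injective e) i<j)

prefixes-unique : ∀ (W : List (List ℕ)) (L : List ℕ) → Unique W → Unique L → Unique (concatMap (λ a → map (a ∷_) W) L)
prefixes-unique W []      uW uL        = []
prefixes-unique W (a ∷ L) uW (aL ∷ uL) = ++⁺ (map⁺ ∷-injective uW) (prefixes-unique W L uW uL) disjoint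
  where
  ∷-injective : ∀ {x y : List ℕ} → (a ∷ x) ≡ (a ∷ y) → x ≡ y
  ∷-injective refl = refl
  disjoint : ∀ {v} → ¬ (v ∈ map (a ∷_) W × v ∈ concatMap (λ a → map (a ∷_) W) L)
  disjoint (m₁ , m₂) with ∈-map⁻ (a ∷_) m₁ | find (∈-concatMap⁻ (λ a → map (a ∷_) W) {xs = L} m₂)
  ... | u , _ , refl | b , bm , m₃ with ∈-map⁻ (b ∷_) m₃
  ... | u' , _ , e = All.lookup aL bm (cong (headOr 0) e)

words-unique : ∀ m n → Unique (words m n)
words-unique zero    n = [] ∷ []
words-unique (suc m) n = prefixes-unique (words m n) (range1 n) (words-unique m n) (range1-unique n)

inQ? : ℕ → List ℕ → Bool
inQ? n w = isMultiset n w ∧ stirlingCond w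

Q-unique : ∀ n → Unique (Q n)
Q-unique n = filter⁺ (λ w → T? (inQ? n w)) (words-unique (2 * n) n)

record InQ (n : ℕ) (σ : List ℕ) : Set where
  field
    len      : length σ ≡ 2 * n
    range    : All (_∈ range1 n) σ
    twice    : isMultiset n σ ≡ true
    stirling : Stirling σ

Q-sound : ∀ n σ → σ ∈ Q n → InQ n σ
Q-sound n σ m with ∈-filter⁻ (λ w → T? (inQ? n w)) {xs = words (2 * n) n} m
... | wm , t with words-sound (2 * n) n σ wm | isMultiset n σ in e₁ | stirlingCond σ in e₂
... | l , r | true | true = record { len = l ; range = r ; twice = e₁ ; stirling = stirlingCond⇒Stirling σ e₂ }

Q-complete : ∀ n σ → InQ n σ → σ ∈ Q n
Q-complete n σ q = ∈-filter⁺ (λ w → T? (inQ? n w)) (words-complete (2 * n) n σ (InQ.len q) (InQ.range q))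
  (true⇒T (cong₂ _∧_ (InQ.twice q) (Stirling⇒stirlingCond σ (InQ.stirling q))))

occ-twice : ∀ {n σ} → InQ n σ → ∀ {i} → i ∈ range1 n → occ i σ ≡ 2
occ-twice {n} {σ} q m = ≡ᵇ-sound (all-elim (λ i → occ i σ ≡ᵇ 2) (range1 n) (InQ.twice q) m)

InQ-↭ : ∀ n σ σ' → InQ n σ → σ ↭ σ' → Stirling σ' → InQ n σ'
InQ-↭ n σ σ' q p s = record
  { len      = trans (sym (↭-length p)) (InQ.len q)
  ; range    = All-resp-↭ p (InQ.range q)
  ; twice    = trans (all-cong _ _ (range1 n) (λ i → cong (_≡ᵇ 2) (sym (occ-↭ i p)))) (InQ.twice q)
  ; stirling = s }

InQ-pos : ∀ {n σ v} → InQ n σ → v ∈ σ → 0 < v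
InQ-pos q m = ∈-range1-pos (All.lookup (InQ.range q) m)

-- A statistic counts the positions i whose
-- window (σ_{i-1}, σ_i, σ_{i+1}) satisfies a ternary test; 'windows P p w'
-- counts these windows recursively, p being the entry before w.

Test : Set
Test = ℕ → ℕ → ℕ → Bool

bit : Bool → ℕ
bit true  = 1
bit false = 0

windows : Test → ℕ → List ℕ → ℕ
windows P p []          = 0
windows P p (x ∷ [])    = 0
windows P p (x ∷ y ∷ r) = bit (P p x y) + windows P x (y ∷ r)

countBelow : (ℕ → Bool) → ℕ → ℕ
countBelow f zero    = 0
countBelow f (suc k) = bit (f 0) + countBelow (λ i → f (suc i)) k

length-filter-applyUpTo : ∀ (g : ℕ → Bool) (h : ℕ → ℕ) k →
  length (filter (λ i → T? (g i)) (applyUpTo h k)) ≡ countBelow (λ i → g (h i)) k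
length-filter-applyUpTo g h zero = refl
length-filter-applyUpTo g h (suc k) with g (h 0)
... | true  = cong suc (length-filter-applyUpTo g (λ i → h (suc i)) k)
... | false = length-filter-applyUpTo g (λ i → h (suc i)) k

countBelow-windows : ∀ P p w →
  countBelow (λ i → P (at (p ∷ w) i) (at w i) (at w (suc i))) (length w ∸ 1) ≡ windows P p w
countBelow-windows P p []          = refl
countBelow-windows P p (x ∷ [])    = refl
countBelow-windows P p (x ∷ y ∷ r) = cong (bit (P p x y) +_) (countBelow-windows P x (y ∷ r))

countPos≡windows : ∀ P σ → countPos P σ ≡ windows P 0 σ
countPos≡windows P σ = trans (length-filter-applyUpTo _ suc (length σ ∸ 1)) (countBelow-windows P 0 σ)

-- The windows centred inside X, when X is preceded by p and followed by c.
windowsIn : Test → ℕ → List ℕ → ℕ → ℕ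
windowsIn P p []      c = 0
windowsIn P p (x ∷ X) c = bit (P p x (headOr c X)) + windowsIn P x X c

windows-++ : ∀ P p X c C → windows P p (X ++ c ∷ C) ≡ windowsIn P p X c + windows P (lastOr p X) (c ∷ C)
windows-++ P p []          c C = refl
windows-++ P p (x ∷ [])    c C = cong (_+ windows P x (c ∷ C)) (sym (+-identityʳ (bit (P p x c))))
windows-++ P p (x ∷ y ∷ X) c C =
  trans (cong (bit (P p x y) +_) (windows-++ P x (y ∷ X) c C))
        (sym (+-assoc (bit (P p x y)) (windowsIn P x (y ∷ X) c) _))

-- Only the last window of X sees the right neighbour c.
windowsIn-right : ∀ P p X c c' → (∀ a → P a (lastOr p X) c ≡ P a (lastOr p X) c')
                → windowsIn P p X c ≡ windowsIn P p X c'
windowsIn-right P p []          c c' h = refl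
windowsIn-right P p (x ∷ [])    c c' h = cong (λ t → bit t + 0) (h p)
windowsIn-right P p (x ∷ y ∷ X) c c' h = cong (bit (P p x y) +_) (windowsIn-right P x (y ∷ X) c c' h)

-- Only the first window of X sees the left neighbour p.
windowsIn-left : ∀ P p p' x X c → (∀ d → P p x d ≡ P p' x d) → windowsIn P p (x ∷ X) c ≡ windowsIn P p' (x ∷ X) c
windowsIn-left P p p' x X c h = cong (_+ windowsIn P x X c) (cong bit (h (headOr c X)))

-- Only the first window of v ∷ Y sees the left neighbour p, and for Y
-- starting with some y ≠ v only tests of the form P p v y matter.
windows-left : ∀ P p p' v Y → headOr 0 Y ≢ v → (∀ y → y ≢ v → P p v y ≡ P p' v y)
             → windows P p (v ∷ Y) ≡ windows P p' (v ∷ Y)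
windows-left P p p' v []       ne h = refl
windows-left P p p' v (y ∷ Y') ne h = cong (λ t → bit t + windows P v (y ∷ Y')) (h y ne)

lapTest dascTest dpTest : Test
lapTest  a b c = (a <ᵇ b) ∧ (b ≡ᵇ c)
dascTest a b c = (a <ᵇ b) ∧ (b <ᵇ c)
dpTest   a b c = (b <ᵇ a) ∧ (b ≡ᵇ c)

record Move : Set where
  field
    X     : List ℕ
    b     : ℕ
    B     : List ℕ
    v     : ℕ
    Y     : List ℕ
    above : All (v <_) (b ∷ B)
    left  : lastOr 0 X < v
    right : headOr 0 Y ≢ v

  -- X · B v v · Y,  with a descent-plateau at the first v
  before : List ℕ
  before = X ++ (b ∷ B) ++ v ∷ v ∷ Y

  -- X · v B v · Y,  with a double ascent at the first v
  after : List ℕ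
  after = X ++ v ∷ (b ∷ B) ++ v ∷ Y

module _ (m : Move) where
  open Move m

  private
    x : ℕ
    x = lastOr 0 X
    bl : ℕ
    bl = lastOr b B

    v<b : v < b
    v<b = All.head above

    v<bl : v < bl
    v<bl = All-last b b B above

    x<b : x < b
    x<b = <-trans left v<b

    x≢b : x ≢ b
    x≢b e = <-irrefl e x<b

    x≢v : x ≢ v
    x≢v e = <-irrefl e left

    bl≮v : ¬ (bl < v)
    bl≮v = <-asym v<bl

  -- Apart from the window centred at the moved v (in 'after') and the one
  -- centred at the first plateau entry (in 'before'), the move only changes
  -- neighbours: x's right neighbour b ↦ v, b's left neighbour x ↦ v and the
  -- second v's left neighbour v ↦ bl.  If P ignores these changes, the
  -- counts differ only by the two special windows.
  windows-move : ∀ P → (∀ a → P a x b ≡ P a x v) → (∀ d → P x b d ≡ P v b d) → (∀ y → y ≢ v → P v v y ≡ P bl v y)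
               → windows P 0 before + bit (P x v b) ≡ windows P 0 after + bit (P bl v v)
  windows-move P h₁ h₂ h₃ = begin
    windows P 0 before + bit (P x v b)
      ≡⟨ cong (_+ bit (P x v b)) (trans (windows-++ P 0 X b (B ++ v ∷ v ∷ Y)) (cong (windowsIn P 0 X b +_) (windows-++ P x (b ∷ B) v (v ∷ Y)))) ⟩
    (windowsIn P 0 X b + (windowsIn P x (b ∷ B) v + (bit (P bl v v) + windows P v (v ∷ Y)))) + bit (P x v b)
      ≡⟨ cong₃ (λ s t u → (s + (t + (bit (P bl v v) + u))) + bit (P x v b))
               (windowsIn-right P 0 X b v h₁) (windowsIn-left P x v b B v h₂) (windows-left P v bl v Y right h₃) ⟩
    (windowsIn P 0 X v + (windowsIn P v (b ∷ B) v + (bit (P bl v v) + windows P bl (v ∷ Y)))) + bit (P x v b)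
      ≡⟨ rearrange (windowsIn P 0 X v) (windowsIn P v (b ∷ B) v) (bit (P bl v v)) (windows P bl (v ∷ Y)) (bit (P x v b)) ⟩
    (windowsIn P 0 X v + (bit (P x v b) + (windowsIn P v (b ∷ B) v + windows P bl (v ∷ Y)))) + bit (P bl v v)
      ≡⟨ cong (_+ bit (P bl v v)) (sym (trans (windows-++ P 0 X v (b ∷ B ++ v ∷ Y)) (cong (λ t → windowsIn P 0 X v + (bit (P x v b) + t)) (windows-++ P v (b ∷ B) v Y)))) ⟩
    windows P 0 after + bit (P bl v v) ∎
    where
    open ≡-Reasoning
    rearrange : ∀ A C p W q → (A + (C + (p + W))) + q ≡ (A + (q + (C + W))) + p
    rearrange = solve-∀

  countPos-move : ∀ P {c c'} → (∀ a → P a x b ≡ P a x v) → (∀ d → P x b d ≡ P v b d) → (∀ y → y ≢ v → P v v y ≡ P bl v y)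
                → bit (P x v b) ≡ c → bit (P bl v v) ≡ c' → countPos P before + c ≡ countPos P after + c'
  countPos-move P h₁ h₂ h₃ refl refl =
    subst₂ (λ s t → s + bit (P x v b) ≡ t + bit (P bl v v))
      (sym (countPos≡windows P before)) (sym (countPos≡windows P after)) (windows-move P h₁ h₂ h₃)

  lap-move : lap before ≡ lap after
  lap-move = subst₂ _≡_ (+-identityʳ _) (+-identityʳ _) (countPos-move lapTest h₁ h₂ h₃ (cong bit e₁) (cong bit e₂))
    where
    h₁ : ∀ a → lapTest a x b ≡ lapTest a x v
    h₁ a rewrite ≡ᵇ-false x≢b | ≡ᵇ-false x≢v = refl
    h₂ : ∀ d → lapTest x b d ≡ lapTest v b d
    h₂ d rewrite <ᵇ-true x<b | <ᵇ-true v<b = refl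
    h₃ : ∀ y → y ≢ v → lapTest v v y ≡ lapTest bl v y
    h₃ y _ rewrite <ᵇ-false {v} {v} (<-irrefl refl) | <ᵇ-false bl≮v = refl
    e₁ : lapTest x v b ≡ false
    e₁ rewrite ≡ᵇ-false (λ e → <-irrefl e v<b) = ∧-zeroʳ (x <ᵇ v)
    e₂ : lapTest bl v v ≡ false
    e₂ rewrite <ᵇ-false bl≮v = refl

  -- The moved v is a double ascent of 'after' but nothing in 'before'.
  dasc-move : suc (dasc before) ≡ dasc after
  dasc-move = subst₂ _≡_ (+-comm (dasc before) 1) (+-identityʳ _) (countPos-move dascTest h₁ h₂ h₃ (cong bit e₁) (cong bit e₂))
    where
    h₁ : ∀ a → dascTest a x b ≡ dascTest a x v
    h₁ a rewrite <ᵇ-true x<b | <ᵇ-true left = refl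
    h₂ : ∀ d → dascTest x b d ≡ dascTest v b d
    h₂ d rewrite <ᵇ-true x<b | <ᵇ-true v<b = refl
    h₃ : ∀ y → y ≢ v → dascTest v v y ≡ dascTest bl v y
    h₃ y _ rewrite <ᵇ-false {v} {v} (<-irrefl refl) | <ᵇ-false bl≮v = refl
    e₁ : dascTest x v b ≡ true
    e₁ rewrite <ᵇ-true left | <ᵇ-true v<b = refl
    e₂ : dascTest bl v v ≡ false
    e₂ rewrite <ᵇ-false bl≮v = refl

  -- The first v of the plateau is a descent-plateau of 'before' only.
  dp-move : dp before ≡ suc (dp after)
  dp-move = subst₂ _≡_ (+-identityʳ _) (+-comm (dp after) 1) (countPos-move dpTest h₁ h₂ h₃ (cong bit e₁) (cong bit e₂))
    where
    h₁ : ∀ a → dpTest a x b ≡ dpTest a x v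
    h₁ a rewrite ≡ᵇ-false x≢b | ≡ᵇ-false x≢v = refl
    h₂ : ∀ d → dpTest x b d ≡ dpTest v b d
    h₂ d rewrite <ᵇ-false (<-asym x<b) | <ᵇ-false (<-asym v<b) = refl
    h₃ : ∀ y → y ≢ v → dpTest v v y ≡ dpTest bl v y
    h₃ y y≢v rewrite <ᵇ-false {v} {v} (<-irrefl refl) | <ᵇ-true v<bl | ≡ᵇ-false (λ e → y≢v (sym e)) = refl
    e₁ : dpTest x v b ≡ false
    e₁ rewrite <ᵇ-false (<-asym left) = refl
    e₂ : dpTest bl v v ≡ true
    e₂ rewrite <ᵇ-true v<bl | ≡ᵇ-true {v} refl = refl

-- Positions (1-based) at which a test holds; countPos is their number.

positions : Test → List ℕ → List ℕ
positions P σ = filter (λ i → T? (P (at (0 ∷ σ) (i ∸ 1)) (at (0 ∷ σ) i) (at (0 ∷ σ) (suc i)))) (range1 (length σ ∸ 1))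

positions-unique : ∀ P σ → Unique (positions P σ)
positions-unique P σ = filter⁺ _ (range1-unique (length σ ∸ 1))

∈-positions : ∀ P σ i → suc i < length σ → P (at (0 ∷ σ) i) (at σ i) (at σ (suc i)) ≡ true → suc i ∈ positions P σ
∈-positions P σ i lt e =
  ∈-filter⁺ (λ j → T? (P (at (0 ∷ σ) (j ∸ 1)) (at (0 ∷ σ) j) (at (0 ∷ σ) (suc j))))
    (∈-applyUpTo⁺ suc (pred-< lt)) (true⇒T e)
  where
  pred-< : ∀ {i n} → suc i < n → i < n ∸ 1
  pred-< {i} {suc n} (s≤s p) = p

positions-∈ : ∀ P σ p → p ∈ positions P σ
            → Σ ℕ λ i → (p ≡ suc i) × (suc i < length σ) × (P (at (0 ∷ σ) i) (at σ i) (at σ (suc i)) ≡ true)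
positions-∈ P σ p m
  with ∈-filter⁻ (λ j → T? (P (at (0 ∷ σ) (j ∸ 1)) (at (0 ∷ σ) j) (at (0 ∷ σ) (suc j)))) {xs = range1 (length σ ∸ 1)} m
... | rm , t with ∈-applyUpTo⁻ suc rm
... | i , lt , refl = i , refl , suc-< lt , T⇒true t
  where
  suc-< : ∀ {i n} → i < n ∸ 1 → suc i < n
  suc-< {i} {suc n} p = s≤s p

∈-positions-cut : ∀ P X v w C → P (lastOr 0 X) v w ≡ true → suc (length X) ∈ positions P (X ++ v ∷ w ∷ C)
∈-positions-cut P X v w C e = ∈-positions P (X ++ v ∷ w ∷ C) (length X) (cut-length X) e'
  where
  cut-length : ∀ (W : List ℕ) → suc (length W) < length (W ++ v ∷ w ∷ C)
  cut-length []      = s≤s (s≤s z≤n)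
  cut-length (x ∷ W) = s≤s (cut-length W)
  e' : P (at (0 ∷ X ++ v ∷ w ∷ C) (length X)) (at (X ++ v ∷ w ∷ C) (length X)) (at (X ++ v ∷ w ∷ C) (suc (length X))) ≡ true
  e' rewrite at-before-++ 0 X (v ∷ w ∷ C) | at-middle X v (w ∷ C) | at-middle₂ X v w C = e

-- Splitting a word T as X ++ B with B the maximal suffix of entries > v.
-- Prepending a to a word already split as (X , B).
splitStep : ℕ → ℕ → List ℕ × List ℕ → List ℕ × List ℕ
splitStep v a ([] , B)    = if v <ᵇ a then ([] , a ∷ B) else (a ∷ [] , B)
splitStep v a (x ∷ X , B) = (a ∷ x ∷ X , B)

splitAbove : ℕ → List ℕ → List ℕ × List ℕ
splitAbove v []      = [] , []
splitAbove v (a ∷ L) = splitStep v a (splitAbove v L)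

record SplitAbove (v : ℕ) (T : List ℕ) (X B : List ℕ) : Set where
  field
    concat   : X ++ B ≡ T
    above    : All (v <_) B
    maximal  : ¬ (v < lastOr 0 X)
    nonempty : v < lastOr 0 T → Σ ℕ λ b → Σ (List ℕ) λ B' → B ≡ b ∷ B'

splitAbove-spec : ∀ v T → SplitAbove v T (proj₁ (splitAbove v T)) (proj₂ (splitAbove v T))
splitAbove-spec v [] = record { concat = refl ; above = [] ; maximal = λ () ; nonempty = λ () }
splitAbove-spec v (a ∷ L) with splitAbove v L | splitAbove-spec v L
... | x ∷ X , B | sp = record
  { concat = cong (a ∷_) (SplitAbove.concat sp) ; above = SplitAbove.above sp ; maximal = SplitAbove.maximal sp
  ; nonempty = λ lt → SplitAbove.nonempty sp (subst (v <_) (last-cons L (SplitAbove.concat sp)) lt) }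
  where
  last-cons : ∀ L → x ∷ X ++ B ≡ L → lastOr a L ≡ lastOr 0 L
  last-cons (l ∷ L) e = refl
... | [] , B | sp with v <ᵇ a in e
...   | true  = record { concat = cong (a ∷_) (SplitAbove.concat sp) ; above = <ᵇ-sound e ∷ SplitAbove.above sp
                       ; maximal = λ () ; nonempty = λ _ → a , B , refl }
...   | false = record { concat = cong (a ∷_) (SplitAbove.concat sp) ; above = SplitAbove.above sp
                       ; maximal = <ᵇ-false⇒≮ e
                       ; nonempty = nonempty' L (SplitAbove.nonempty sp) }
  where
  nonempty' : ∀ L → (v < lastOr 0 L → Σ ℕ λ b → Σ (List ℕ) λ B' → B ≡ b ∷ B')
            → v < lastOr a L → Σ ℕ λ b → Σ (List ℕ) λ B' → B ≡ b ∷ B'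
  nonempty' []      h lt = ⊥-elim (<ᵇ-false⇒≮ e lt)
  nonempty' (l ∷ L) h lt = h lt

splitAbove-all : ∀ v B → All (v <_) B → splitAbove v B ≡ ([] , B)
splitAbove-all v []      []       = refl
splitAbove-all v (b ∷ B) (p ∷ ps) rewrite splitAbove-all v B ps | <ᵇ-true p = refl

lastOr-not-above : ∀ v x X → ¬ (v < lastOr x X) → ¬ (v < lastOr 0 X)
lastOr-not-above v x []      _ ()
lastOr-not-above v x (y ∷ X) h = h

splitAbove-++ : ∀ v X b B → All (v <_) (b ∷ B) → ¬ (v < lastOr 0 X) → splitAbove v (X ++ b ∷ B) ≡ (X , b ∷ B)
splitAbove-++ v []      b B al nl = splitAbove-all v (b ∷ B) al
splitAbove-++ v (x ∷ X) b B al nl rewrite splitAbove-++ v X b B al (lastOr-not-above v x X nl) = last-step X nl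
  where
  last-step : ∀ X → ¬ (v < lastOr x X) → splitStep v x (X , b ∷ B) ≡ (x ∷ X , b ∷ B)
  last-step []      h rewrite <ᵇ-false h = refl
  last-step (y ∷ X) h = refl

breakAt : ℕ → List ℕ → List ℕ × List ℕ
breakAt v []      = [] , []
breakAt v (a ∷ R) = if a ≡ᵇ v then ([] , R) else (a ∷ proj₁ (breakAt v R) , proj₂ (breakAt v R))

breakAt-spec : ∀ v R → v ∈ R → (R ≡ proj₁ (breakAt v R) ++ v ∷ proj₂ (breakAt v R)) × (v ∉ proj₁ (breakAt v R))
breakAt-spec v (a ∷ R) m with a ≡ᵇ v in e
... | true = cong (_∷ R) (≡ᵇ-sound e) , (λ ())
... | false with m
...   | here v≡a = ⊥-elim (≡ᵇ-false⇒≢ e (sym v≡a))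
...   | there m' = cong (a ∷_) (proj₁ (breakAt-spec v R m'))
                 , λ { (here v≡a) → ≡ᵇ-false⇒≢ e (sym v≡a) ; (there k) → proj₂ (breakAt-spec v R m') k }

breakAt-++ : ∀ v B Y → v ∉ B → breakAt v (B ++ v ∷ Y) ≡ (B , Y)
breakAt-++ v []      Y _ rewrite ≡ᵇ-true {v} {v} refl = refl
breakAt-++ v (a ∷ B) Y nB rewrite ≡ᵇ-false {a} {v} (λ e → nB (here (sym e))) | breakAt-++ v B Y (λ m → nB (there m)) = refl

-- The move and its inverse on (word, position) pairs: a descent-plateau at
-- position p is moved in front of the maximal block above it, giving a
-- double ascent; a double ascent at q is moved back behind its block.

moveForward : List ℕ × ℕ → List ℕ × ℕ
moveForward (σ , p) = (X ++ v ∷ B ++ v ∷ drop (suc p) σ , suc (length X))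
  where
  v : ℕ
  v = at σ (p ∸ 1)
  X : List ℕ
  X = proj₁ (splitAbove v (take (p ∸ 1) σ))
  B : List ℕ
  B = proj₂ (splitAbove v (take (p ∸ 1) σ))

moveBack : List ℕ × ℕ → List ℕ × ℕ
moveBack (σ , q) = (take (q ∸ 1) σ ++ B ++ v ∷ v ∷ Y , suc (length (take (q ∸ 1) σ) + length B))
  where
  v : ℕ
  v = at σ (q ∸ 1)
  B : List ℕ
  B = proj₁ (breakAt v (drop q σ))
  Y : List ℕ
  Y = proj₂ (breakAt v (drop q σ))

module _ (m : Move) where
  open Move m

  plateauPos : ℕ
  plateauPos = suc (length X + length (b ∷ B))

  ascentPos : ℕ
  ascentPos = suc (length X)

  private
    before-assoc : before ≡ (X ++ b ∷ B) ++ v ∷ v ∷ Y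
    before-assoc = sym (++-assoc X (b ∷ B) (v ∷ v ∷ Y))

    plateauPos-assoc : plateauPos ≡ suc (length (X ++ b ∷ B))
    plateauPos-assoc = cong suc (sym (length-++ X))

  plateauPos-dp : plateauPos ∈ positions dpTest before
  plateauPos-dp = subst₂ (λ s t → t ∈ positions dpTest s) (sym before-assoc) (sym plateauPos-assoc)
    (∈-positions-cut dpTest (X ++ b ∷ B) v v Y e)
    where
    e : dpTest (lastOr 0 (X ++ b ∷ B)) v v ≡ true
    e rewrite lastOr-++ 0 X b B | <ᵇ-true (All-last b b B above) | ≡ᵇ-true {v} refl = refl

  ascentPos-dasc : ascentPos ∈ positions dascTest after
  ascentPos-dasc = ∈-positions-cut dascTest X v b (B ++ v ∷ Y) e
    where
    e : dascTest (lastOr 0 X) v b ≡ true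
    e rewrite <ᵇ-true left | <ᵇ-true (All.head above) = refl

  moveForward-move : moveForward (before , plateauPos) ≡ (after , ascentPos)
  moveForward-move = trans (cong moveForward (cong₂ _,_ before-assoc plateauPos-assoc)) forward
    where
    forward : moveForward ((X ++ b ∷ B) ++ v ∷ v ∷ Y , suc (length (X ++ b ∷ B))) ≡ (after , ascentPos)
    forward rewrite at-middle (X ++ b ∷ B) v (v ∷ Y) | take-++ (X ++ b ∷ B) (v ∷ v ∷ Y)
      | splitAbove-++ v X b B above (<-asym left) | drop-++₂ (X ++ b ∷ B) v v Y = refl

  moveBack-move : moveBack (after , ascentPos) ≡ (before , plateauPos)
  moveBack-move rewrite at-middle X v ((b ∷ B) ++ v ∷ Y) | take-++ X (v ∷ (b ∷ B) ++ v ∷ Y)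
    | drop-++₁ X v ((b ∷ B) ++ v ∷ Y) | breakAt-++ v (b ∷ B) Y (All<⇒∉ v (b ∷ B) above) = refl

record QMove (n : ℕ) : Set where
  field
    move    : Move
    before∈ : InQ n (Move.before move)
    after∈  : InQ n (Move.after move)

-- The entries next to the segment moved are different from v: nothing
-- before a plateau v v equals v, no v follows it, and the default 0 < v.
lastOr-≢ : ∀ X A v Y → 0 < v → Stirling (X ++ A ++ v ∷ v ∷ Y) → lastOr 0 X ≢ v
lastOr-≢ []      A v Y p s e = <-irrefl e p
lastOr-≢ (x ∷ X) A v Y p s e = plateau-not-in-prefix (x ∷ X) A v Y (subst (_∈ x ∷ X) e (lastOr-∈ 0 x X)) s

headOr-≢ : ∀ v Y → 0 < v → v ∉ Y → headOr 0 Y ≢ v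
headOr-≢ v []      p _ e = <-irrefl e p
headOr-≢ v (y ∷ Y) p n e = n (here (sym e))

plateau-move : ∀ n X b B v Y → InQ n (X ++ (b ∷ B) ++ v ∷ v ∷ Y) → All (v <_) (b ∷ B) → ¬ (v < lastOr 0 X) → QMove n
plateau-move n X b B v Y q above maximal = record
  { move    = mv
  ; before∈ = q
  ; after∈  = InQ-↭ n _ _ q (++⁺ˡ X (shift v (b ∷ B) (v ∷ Y))) (Stirling-move X (b ∷ B) v Y (InQ.stirling q) above left) }
  where
  st : Stirling (X ++ (b ∷ B) ++ v ∷ v ∷ Y)
  st = InQ.stirling q
  v>0 : 0 < v
  v>0 = InQ-pos q (∈-++⁺ʳ X (∈-++⁺ʳ (b ∷ B) (here refl)))
  left : lastOr 0 X < v
  left = ≤∧≢⇒< (≮⇒≥ maximal) (lastOr-≢ X (b ∷ B) v Y v>0 st)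
  right : headOr 0 Y ≢ v
  right = headOr-≢ v Y v>0 (plateau-last (X ++ b ∷ B) v Y (subst Stirling (sym (++-assoc X (b ∷ B) (v ∷ v ∷ Y))) st))
  mv : Move
  mv = record { X = X ; b = b ; B = B ; v = v ; Y = Y ; above = above ; left = left ; right = right }

ascent-move : ∀ n X b B v Y → InQ n (X ++ v ∷ (b ∷ B) ++ v ∷ Y) → lastOr 0 X < v → QMove n
ascent-move n X b B v Y q left with Stirling-unmove X (b ∷ B) v Y (InQ.stirling q) left
... | st , above , v∉Y = record
  { move    = record { X = X ; b = b ; B = B ; v = v ; Y = Y ; above = above ; left = left
                     ; right = headOr-≢ v Y (InQ-pos q (∈-++⁺ʳ X (here refl))) v∉Y }
  ; before∈ = InQ-↭ n _ _ q (↭-sym (++⁺ˡ X (shift v (b ∷ B) (v ∷ Y)))) st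
  ; after∈  = q }

-- Every descent-plateau of an element of 𝒬ₙ is the plateau of a move: cut
-- the word as T · v v · Y at the plateau and split off the maximal block of
-- T above v.

dp-is-move-at : ∀ n σ i v T Y → InQ n σ → σ ≡ T ++ v ∷ v ∷ Y → length T ≡ i → v < lastOr 0 T
              → Σ (QMove n) λ m → (σ ≡ Move.before (QMove.move m)) × (suc i ≡ plateauPos (QMove.move m))
dp-is-move-at n σ i v T Y q shape len v<last with splitAbove v T | splitAbove-spec v T
... | X , B₀ | sp with SplitAbove.nonempty sp v<last
...   | b , B , refl = finish σ (trans shape (cong (_++ v ∷ v ∷ Y) (sym (SplitAbove.concat sp))))
                              (trans (cong length (SplitAbove.concat sp)) len) q
  where
  finish : ∀ σ → σ ≡ (X ++ b ∷ B) ++ v ∷ v ∷ Y → length (X ++ b ∷ B) ≡ i → InQ n σ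
         → Σ (QMove n) λ m → (σ ≡ Move.before (QMove.move m)) × (suc i ≡ plateauPos (QMove.move m))
  finish σ refl refl q' =
      plateau-move n X b B v Y (subst (InQ n) (++-assoc X (b ∷ B) (v ∷ v ∷ Y)) q') (SplitAbove.above sp) (SplitAbove.maximal sp)
    , ++-assoc X (b ∷ B) (v ∷ v ∷ Y) , cong suc (length-++ X)

dp-is-move : ∀ n σ p → InQ n σ → p ∈ positions dpTest σ
           → Σ (QMove n) λ m → (σ ≡ Move.before (QMove.move m)) × (p ≡ plateauPos (QMove.move m))
dp-is-move n σ p q mem with positions-∈ dpTest σ p mem
... | i , refl , lt , e =
  dp-is-move-at n σ i (at σ i) (take i σ) (drop (suc (suc i)) σ) q shape
    (length-take-≤ σ i i≤) (subst (at σ i <_) (at-before 0 σ i i≤) (<ᵇ-sound (∧-true₁ e)))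
  where
  i≤ : i ≤ length σ
  i≤ = <⇒≤ (<-trans (n<1+n i) lt)
  plateau : at σ (suc i) ≡ at σ i
  plateau = sym (≡ᵇ-sound (∧-true₂ {at σ i <ᵇ at (0 ∷ σ) i} e))
  shape : σ ≡ take i σ ++ at σ i ∷ at σ i ∷ drop (suc (suc i)) σ
  shape = subst (λ t → σ ≡ take i σ ++ at σ i ∷ t ∷ drop (suc (suc i)) σ) plateau (split-at₂ σ i lt)

-- Every double ascent v r of an element of 𝒬ₙ is the moved entry of a move:
-- the second copy of v lies after r, and the entries strictly between are
-- the block B.

dasc-is-move-at : ∀ n σ i X v r R → InQ n σ → σ ≡ X ++ v ∷ r ∷ R → length X ≡ i → lastOr 0 X < v → v < r
                → Σ (QMove n) λ m → (σ ≡ Move.after (QMove.move m)) × (suc i ≡ ascentPos (QMove.move m))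
dasc-is-move-at n σ i X v r R q refl len left v<r with breakAt-spec v R v∈R
  where
  v∉X : v ∉ X
  v∉X m = <-irrefl refl (shared-below X (v ∷ r ∷ R) v (InQ.stirling q) left m (here refl))
  occ-v : occ v (X ++ v ∷ r ∷ R) ≡ suc (occ v R)
  occ-v rewrite occ-++ v X (v ∷ r ∷ R) | occ-∉ v X v∉X | occ-self v (r ∷ R) | ≡ᵇ-false {v} {r} (λ e → <-irrefl e v<r) = refl
  twice : suc (occ v R) ≡ 2
  twice = trans (sym occ-v) (occ-twice q (All.lookup (InQ.range q) (∈-++⁺ʳ X (here refl))))
  v∈R : v ∈ R
  v∈R = occ-∈ v R (λ occ≡0 → case trans (sym twice) (cong suc occ≡0) of λ ())
... | shape , v∉B =
    ascent-move n X r (proj₁ (breakAt v R)) v (proj₂ (breakAt v R)) (subst (λ t → InQ n (X ++ v ∷ r ∷ t)) shape q) left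
  , cong (λ t → X ++ v ∷ r ∷ t) shape , cong suc (sym len)

dasc-is-move : ∀ n σ q → InQ n σ → q ∈ positions dascTest σ
             → Σ (QMove n) λ m → (σ ≡ Move.after (QMove.move m)) × (q ≡ ascentPos (QMove.move m))
dasc-is-move n σ q inQ mem with positions-∈ dascTest σ q mem
... | i , refl , lt , e =
  dasc-is-move-at n σ i (take i σ) (at σ i) (at σ (suc i)) (drop (suc (suc i)) σ) inQ (split-at₂ σ i lt)
    (length-take-≤ σ i i≤) (subst (_< at σ i) (at-before 0 σ i i≤) (<ᵇ-sound (∧-true₁ e)))
    (<ᵇ-sound (∧-true₂ {at (0 ∷ σ) i <ᵇ at σ i} e))
  where
  i≤ : i ≤ length σ
  i≤ = <⇒≤ (<-trans (n<1+n i) lt)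

∈-remove : ∀ {A : Set} {x y : A} ys₁ ys₂ → y ∈ ys₁ ++ x ∷ ys₂ → y ≢ x → y ∈ ys₁ ++ ys₂
∈-remove []        ys₂ (here e)  ne = ⊥-elim (ne e)
∈-remove []        ys₂ (there m) ne = m
∈-remove (z ∷ ys₁) ys₂ (here e)  ne = here e
∈-remove (z ∷ ys₁) ys₂ (there m) ne = there (∈-remove ys₁ ys₂ m ne)

unique-⊆-length : ∀ {A : Set} (xs ys : List A) → Unique xs → (∀ {x} → x ∈ xs → x ∈ ys) → length xs ≤ length ys
unique-⊆-length []       ys u         s = z≤n
unique-⊆-length (x ∷ xs) ys (x∉ ∷ u) s with ∈-∃++ (s (here refl))
... | ys₁ , ys₂ , refl = subst (suc (length xs) ≤_) (sym length-split)
  (s≤s (unique-⊆-length xs (ys₁ ++ ys₂) u (λ m → ∈-remove ys₁ ys₂ (s (there m)) (λ e → All.lookup x∉ m (sym e)))))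
  where
  length-split : length (ys₁ ++ x ∷ ys₂) ≡ suc (length (ys₁ ++ ys₂))
  length-split = trans (length-++ ys₁) (trans (+-suc (length ys₁) (length ys₂)) (cong suc (sym (length-++ ys₁))))

map-unique : ∀ {A B : Set} (f : A → B) (g : B → A) (xs : List A) → Unique xs → (∀ {x} → x ∈ xs → g (f x) ≡ x)
           → Unique (map f xs)
map-unique f g []       u         h = []
map-unique f g (x ∷ xs) (x∉ ∷ u) h =
    All-map⁺ (All.tabulate λ {y} m e → All.lookup x∉ m (trans (sym (h (here refl))) (trans (cong g e) (h (there m)))))
  ∷ map-unique f g xs u (λ m → h (there m))

injection-length : ∀ {A B : Set} (L₁ : List A) (L₂ : List B) (f : A → B) (g : B → A) → Unique L₁
                 → (∀ {x} → x ∈ L₁ → f x ∈ L₂) → (∀ {x} → x ∈ L₁ → g (f x) ≡ x) → length L₁ ≤ length L₂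
injection-length L₁ L₂ f g u into inverse = subst (_≤ length L₂) (length-map f L₁)
  (unique-⊆-length (map f L₁) L₂ (map-unique f g L₁ u inverse) image)
  where
  image : ∀ {y} → y ∈ map f L₁ → y ∈ L₂
  image m with ∈-map⁻ f m
  ... | x , xm , refl = into xm

pairs : Test → List (List ℕ) → List (List ℕ × ℕ)
pairs P L = concatMap (λ σ → map (σ ,_) (positions P σ)) L

pairs-∈ : ∀ P L {σ p} → (σ , p) ∈ pairs P L → σ ∈ L × p ∈ positions P σ
pairs-∈ P L m with find (∈-concatMap⁻ (λ σ → map (σ ,_) (positions P σ)) {xs = L} m)
... | τ , τm , m₂ with ∈-map⁻ (τ ,_) m₂
... | q , qm , refl = τm , qm

∈-pairs : ∀ P L {σ p} → σ ∈ L → p ∈ positions P σ → (σ , p) ∈ pairs P L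
∈-pairs P L {σ} sm pm = ∈-concatMap⁺ (λ σ → map (σ ,_) (positions P σ)) {xs = L}
  (Any.map (λ { refl → ∈-map⁺ (σ ,_) pm }) sm)

pairs-unique : ∀ P L → Unique L → Unique (pairs P L)
pairs-unique P []      u         = []
pairs-unique P (σ ∷ L) (σ∉ ∷ u) = ++⁺ (map⁺ ,-injective (positions-unique P σ)) (pairs-unique P L u) disjoint
  where
  ,-injective : ∀ {x y : ℕ} → (σ , x) ≡ (σ , y) → x ≡ y
  ,-injective refl = refl
  disjoint : ∀ {v} → ¬ (v ∈ map (σ ,_) (positions P σ) × v ∈ pairs P L)
  disjoint (m₁ , m₂) with ∈-map⁻ (σ ,_) m₁
  ... | q , _ , refl = All.lookup σ∉ (proj₁ (pairs-∈ P L m₂)) refl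

length-pairs : ∀ P L c → (∀ {σ} → σ ∈ L → countPos P σ ≡ c) → length (pairs P L) ≡ length L * c
length-pairs P []      c h = refl
length-pairs P (σ ∷ L) c h = trans (length-++ (map (σ ,_) (positions P σ)))
  (cong₂ _+_ (trans (length-map (σ ,_) (positions P σ)) (h (here refl))) (length-pairs P L c (λ m → h (there m))))

classTest : ℕ → ℕ → ℕ → List ℕ → Bool
classTest i j b σ = (lap σ ≡ᵇ i) ∧ ((dasc σ + dp σ) ≡ᵇ j) ∧ (dp σ ≡ᵇ b)

class : ℕ → ℕ → ℕ → ℕ → List (List ℕ)
class n i j b = filter (λ σ → T? (classTest i j b σ)) (Q n)

K : ℕ → ℕ → ℕ → ℕ → ℕ
K n i j b = length (class n i j b)

record InClass (n i j b : ℕ) (σ : List ℕ) : Set where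
  field
    inQ   : InQ n σ
    lap≡  : lap σ ≡ i
    stat≡ : dasc σ + dp σ ≡ j
    dp≡   : dp σ ≡ b

class-sound : ∀ n i j b σ → σ ∈ class n i j b → InClass n i j b σ
class-sound n i j b σ m with ∈-filter⁻ (λ σ → T? (classTest i j b σ)) {xs = Q n} m
... | qm , t = record
  { inQ   = Q-sound n σ qm
  ; lap≡  = ≡ᵇ-sound (∧-true₁ t')
  ; stat≡ = ≡ᵇ-sound (∧-true₁ (∧-true₂ {lap σ ≡ᵇ i} t'))
  ; dp≡   = ≡ᵇ-sound (∧-true₂ {(dasc σ + dp σ) ≡ᵇ j} (∧-true₂ {lap σ ≡ᵇ i} t')) }
  where
  t' : classTest i j b σ ≡ true
  t' = T⇒true t

class-complete : ∀ n i j b σ → InClass n i j b σ → σ ∈ class n i j b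
class-complete n i j b σ c = ∈-filter⁺ (λ σ → T? (classTest i j b σ)) (Q-complete n σ (InClass.inQ c))
  (true⇒T (cong₂ _∧_ (≡ᵇ-true (InClass.lap≡ c)) (cong₂ _∧_ (≡ᵇ-true (InClass.stat≡ c)) (≡ᵇ-true (InClass.dp≡ c)))))

class-unique : ∀ n i j b → Unique (class n i j b)
class-unique n i j b = filter⁺ (λ σ → T? (classTest i j b σ)) (Q-unique n)

-- A move trades one descent-plateau for one double ascent, so it maps the
-- class b+1 to the class b and back.

stat-move : ∀ m → dasc (Move.after m) + dp (Move.after m) ≡ dasc (Move.before m) + dp (Move.before m)
stat-move m = begin
  dasc after + dp after              ≡⟨ cong (_+ dp after) (sym (dasc-move m)) ⟩
  suc (dasc before) + dp after       ≡⟨ sym (+-suc (dasc before) (dp after)) ⟩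
  dasc before + suc (dp after)       ≡⟨ cong (dasc before +_) (sym (dp-move m)) ⟩
  dasc before + dp before            ∎
  where
  open ≡-Reasoning
  open Move m using (before; after)

module _ {n i j b : ℕ} (m : Move) where
  open Move m using (before; after)

  move-class : InClass n i j (suc b) before → InQ n after → InClass n i j b after
  move-class c q = record
    { inQ   = q
    ; lap≡  = trans (sym (lap-move m)) (InClass.lap≡ c)
    ; stat≡ = trans (stat-move m) (InClass.stat≡ c)
    ; dp≡   = suc-injective (trans (sym (dp-move m)) (InClass.dp≡ c)) }

  unmove-class : InClass n i j b after → InQ n before → InClass n i j (suc b) before
  unmove-class c q = record
    { inQ   = q
    ; lap≡  = trans (lap-move m) (InClass.lap≡ c)
    ; stat≡ = trans (sym (stat-move m)) (InClass.stat≡ c)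
    ; dp≡   = trans (dp-move m) (cong suc (InClass.dp≡ c)) }

forward : ∀ n i j b {x} → x ∈ pairs dpTest (class n i j (suc b))
        → moveForward x ∈ pairs dascTest (class n i j b) × moveBack (moveForward x) ≡ x
forward n i j b {σ , p} mem with pairs-∈ dpTest (class n i j (suc b)) mem
... | σ∈ , p∈ with class-sound n i j (suc b) σ σ∈
... | c with dp-is-move n σ p (InClass.inQ c) p∈
... | qm , refl , refl =
    subst (_∈ pairs dascTest (class n i j b)) (sym (moveForward-move m))
      (∈-pairs dascTest (class n i j b) (class-complete n i j b _ (move-class m c (QMove.after∈ qm))) (ascentPos-dasc m))
  , trans (cong moveBack (moveForward-move m)) (moveBack-move m)
  where
  m : Move
  m = QMove.move qm

backward : ∀ n i j b {x} → x ∈ pairs dascTest (class n i j b)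
         → moveBack x ∈ pairs dpTest (class n i j (suc b)) × moveForward (moveBack x) ≡ x
backward n i j b {σ , q} mem with pairs-∈ dascTest (class n i j b) mem
... | σ∈ , q∈ with class-sound n i j b σ σ∈
... | c with dasc-is-move n σ q (InClass.inQ c) q∈
... | qm , refl , refl =
    subst (_∈ pairs dpTest (class n i j (suc b))) (sym (moveBack-move m))
      (∈-pairs dpTest (class n i j (suc b)) (class-complete n i j (suc b) _ (unmove-class m c (QMove.before∈ qm))) (plateauPos-dp m))
  , trans (cong moveForward (moveBack-move m)) (moveForward-move m)
  where
  m : Move
  m = QMove.move qm

class-recurrence : ∀ n i j b → K n i j (suc b) * suc b ≡ K n i j b * (j ∸ b)
class-recurrence n i j b = begin
  K n i j (suc b) * suc b
    ≡⟨ sym (length-pairs dpTest (class n i j (suc b)) (suc b) (λ {σ} m → InClass.dp≡ (class-sound n i j (suc b) σ m))) ⟩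
  length plateaus
    ≡⟨ ≤-antisym
         (injection-length plateaus ascents moveForward moveBack (pairs-unique dpTest _ (class-unique n i j (suc b)))
            (λ m → proj₁ (forward n i j b m)) (λ m → proj₂ (forward n i j b m)))
         (injection-length ascents plateaus moveBack moveForward (pairs-unique dascTest _ (class-unique n i j b))
            (λ m → proj₁ (backward n i j b m)) (λ m → proj₂ (backward n i j b m))) ⟩
  length ascents
    ≡⟨ length-pairs dascTest (class n i j b) (j ∸ b) (λ {σ} m → dasc≡ σ (class-sound n i j b σ m)) ⟩
  K n i j b * (j ∸ b) ∎
  where
  open ≡-Reasoning
  plateaus : List (List ℕ × ℕ)
  plateaus = pairs dpTest (class n i j (suc b))
  ascents : List (List ℕ × ℕ)
  ascents = pairs dascTest (class n i j b)
  dasc≡ : ∀ σ → InClass n i j b σ → dasc σ ≡ j ∸ b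
  dasc≡ σ c = trans (sym (m+n∸n≡m (dasc σ) (dp σ))) (cong₂ _∸_ (InClass.stat≡ c) (InClass.dp≡ c))

sumTo : ℕ → (ℕ → ℕ) → ℕ
sumTo N f = sum (map f (upTo N))

sum-cong : ∀ {A : Set} (L : List A) (f g : A → ℕ) → (∀ {a} → a ∈ L → f a ≡ g a) → sum (map f L) ≡ sum (map g L)
sum-cong []      f g h = refl
sum-cong (a ∷ L) f g h = cong₂ _+_ (h (here refl)) (sum-cong L f g (λ m → h (there m)))

sum-const : ∀ {A : Set} (L : List A) (f : A → ℕ) c → (∀ {a} → a ∈ L → f a ≡ c) → sum (map f L) ≡ length L * c
sum-const []      f c h = refl
sum-const (a ∷ L) f c h = cong₂ _+_ (h (here refl)) (sum-const L f c (λ m → h (there m)))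

sum-+ : ∀ {A : Set} (L : List A) (f g : A → ℕ) → sum (map (λ a → f a + g a) L) ≡ sum (map f L) + sum (map g L)
sum-+ []      f g = refl
sum-+ (a ∷ L) f g rewrite sum-+ L f g = interchange (f a) (g a) (sum (map f L)) (sum (map g L))
  where
  interchange : ∀ p q r s → p + q + (r + s) ≡ p + r + (q + s)
  interchange = solve-∀

sum-*ˡ : ∀ {A : Set} (L : List A) (f : A → ℕ) c → sum (map (λ a → c * f a) L) ≡ c * sum (map f L)
sum-*ˡ []      f c = sym (*-zeroʳ c)
sum-*ˡ (a ∷ L) f c rewrite sum-*ˡ L f c = sym (*-distribˡ-+ c (f a) (sum (map f L)))

sumTo-last : ∀ N f → sumTo (suc N) f ≡ sumTo N f + f N
sumTo-last N f = begin
  sum (map f (upTo (suc N)))       ≡⟨ cong (λ l → sum (map f l)) (sym (upTo-∷ʳ N)) ⟩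
  sum (map f (upTo N ++ [ N ]))    ≡⟨ cong sum (map-++ f (upTo N) [ N ]) ⟩
  sum (map f (upTo N) ++ [ f N ])  ≡⟨ sum-++ (map f (upTo N)) [ f N ] ⟩
  sumTo N f + (f N + 0)            ≡⟨ cong (sumTo N f +_) (+-identityʳ (f N)) ⟩
  sumTo N f + f N                  ∎
  where open ≡-Reasoning

sumTo-first : ∀ N f → sumTo (suc N) f ≡ f 0 + sumTo N (λ b → f (suc b))
sumTo-first N f = cong (f 0 +_) (cong sum (trans (map-applyUpTo suc f N) (sym (map-applyUpTo (λ x → x) (λ b → f (suc b)) N))))

sumTo-zero : ∀ N f → (∀ k → k < N → f k ≡ 0) → sumTo N f ≡ 0
sumTo-zero zero    f h = refl
sumTo-zero (suc N) f h = trans (sumTo-last N f) (cong₂ _+_ (sumTo-zero N f (λ k l → h k (<-trans l (n<1+n N)))) (h N (n<1+n N)))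

sumTo-single : ∀ a N c → a < N → sumTo N (λ k → if a ≡ᵇ k then c else 0) ≡ c
sumTo-single a (suc N) c lt with a ≟ N
... | yes refl = trans (sumTo-last N _) (cong₂ _+_ (sumTo-zero N _ off) on)
  where
  off : ∀ k → k < N → (if a ≡ᵇ k then c else 0) ≡ 0
  off k k<N rewrite ≡ᵇ-false {a} {k} (λ e → <-irrefl (sym e) k<N) = refl
  on : (if a ≡ᵇ a then c else 0) ≡ c
  on rewrite ≡ᵇ-true {a} refl = refl
... | no a≢N = trans (sumTo-last N _) (trans (cong₂ _+_ (sumTo-single a N c (≤∧≢⇒< (≤-pred lt) a≢N)) off) (+-identityʳ c))
  where
  off : (if a ≡ᵇ N then c else 0) ≡ 0
  off rewrite ≡ᵇ-false a≢N = refl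

sum-partition : ∀ {A : Set} (L : List A) (g h : A → ℕ) N → (∀ {a} → a ∈ L → g a < N)
              → sum (map h L) ≡ sumTo N (λ k → sum (map h (filter (λ a → T? (g a ≡ᵇ k)) L)))
sum-partition []      g h N bound = sym (sumTo-zero N _ (λ _ _ → refl))
sum-partition (a ∷ L) g h N bound = sym (begin
  sumTo N (λ k → sum (map h (part (a ∷ L) k)))
    ≡⟨ sum-cong (upTo N) _ _ (λ {k} _ → cons a L k) ⟩
  sumTo N (λ k → (if g a ≡ᵇ k then h a else 0) + sum (map h (part L k)))
    ≡⟨ sum-+ (upTo N) _ _ ⟩
  sumTo N (λ k → if g a ≡ᵇ k then h a else 0) + sumTo N (λ k → sum (map h (part L k)))
    ≡⟨ cong₂ _+_ (sumTo-single (g a) N (h a) (bound (here refl))) (sym (sum-partition L g h N (λ m → bound (there m)))) ⟩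
  h a + sum (map h L) ∎)
  where
  open ≡-Reasoning
  part : List _ → ℕ → List _
  part L k = filter (λ a → T? (g a ≡ᵇ k)) L
  cons : ∀ a L k → sum (map h (part (a ∷ L) k)) ≡ (if g a ≡ᵇ k then h a else 0) + sum (map h (part L k))
  cons a L k with g a ≡ᵇ k
  ... | true  = refl
  ... | false = refl

filter-cong : ∀ {A : Set} (p q : A → Bool) L → (∀ a → p a ≡ q a) → filter (λ a → T? (p a)) L ≡ filter (λ a → T? (q a)) L
filter-cong p q []      h = refl
filter-cong p q (a ∷ L) h with p a | q a | h a
... | true  | true  | refl = cong (a ∷_) (filter-cong p q L h)
... | false | false | refl = filter-cong p q L h

filter-filter : ∀ {A : Set} (p q : A → Bool) L
              → filter (λ a → T? (q a)) (filter (λ a → T? (p a)) L) ≡ filter (λ a → T? (p a ∧ q a)) L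
filter-filter p q []      = refl
filter-filter p q (a ∷ L) with p a
... | false = filter-filter p q L
... | true with q a
...   | true  = cong (a ∷_) (filter-filter p q L)
...   | false = filter-filter p q L

choose : ℕ → ℕ → ℕ
choose j       zero    = 1
choose zero    (suc b) = 0
choose (suc j) (suc b) = choose j b + choose j (suc b)

choose-zero : ∀ j b → j < b → choose j b ≡ 0
choose-zero zero    (suc b) _        = refl
choose-zero (suc j) (suc b) (s≤s lt) = cong₂ _+_ (choose-zero j b lt) (choose-zero j (suc b) (<-trans lt (n<1+n b)))

∸-suc : ∀ {j b} → b < j → j ∸ b ≡ suc (j ∸ suc b)
∸-suc {j} lt = +-∸-assoc 1 lt

choose-recurrence : ∀ j b → suc b * choose j (suc b) ≡ (j ∸ b) * choose j b
choose-recurrence zero    b rewrite 0∸n≡0 b = *-zeroʳ (suc b)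
choose-recurrence (suc j) zero = begin
  1 * (1 + choose j 1)  ≡⟨ *-identityˡ _ ⟩
  suc (choose j 1)      ≡⟨ cong suc (trans (sym (*-identityˡ (choose j 1))) (trans (choose-recurrence j zero) (*-identityʳ j))) ⟩
  suc j                 ≡⟨ sym (*-identityʳ (suc j)) ⟩
  suc j * 1             ∎
  where open ≡-Reasoning
choose-recurrence (suc j) (suc b) with b <? j
... | no b≮j rewrite choose-zero j (suc b) (s≤s (≮⇒≥ b≮j)) | choose-zero j (suc (suc b)) (s≤s (≤-trans (≮⇒≥ b≮j) (n≤1+n b)))
                   | m≤n⇒m∸n≡0 (≮⇒≥ b≮j) = *-zeroʳ (suc (suc b))
... | yes b<j = begin
  suc (suc b) * (X + Y)               ≡⟨ *-distribˡ-+ (suc (suc b)) X Y ⟩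
  suc (suc b) * X + suc (suc b) * Y   ≡⟨ cong (suc (suc b) * X +_) (choose-recurrence j (suc b)) ⟩
  suc (suc b) * X + d * X             ≡⟨ shift-one b d X ⟩
  suc b * X + suc d * X               ≡⟨ cong (_+ suc d * X) (trans (choose-recurrence j b) (cong (_* W) (∸-suc b<j))) ⟩
  suc d * W + suc d * X               ≡⟨ sym (*-distribˡ-+ (suc d) W X) ⟩
  suc d * (W + X)                     ≡⟨ cong (_* (W + X)) (sym (∸-suc b<j)) ⟩
  (j ∸ b) * (W + X)                   ∎
  where
  open ≡-Reasoning
  W : ℕ
  W = choose j b
  X : ℕ
  X = choose j (suc b)
  Y : ℕ
  Y = choose j (suc (suc b))
  d : ℕ
  d = j ∸ suc b
  shift-one : ∀ b d X → suc (suc b) * X + d * X ≡ suc b * X + suc d * X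
  shift-one = solve-∀

-- The binomial theorem, with the sum running over any range b < N ⊇ [0, j].
module _ (y z : ℕ) where

  binomialTerm : ℕ → ℕ → ℕ
  binomialTerm j b = choose j b * y ^ (j ∸ b) * z ^ b

  binomialTerm-pascal : ∀ j b → binomialTerm (suc j) (suc b) ≡ z * binomialTerm j b + y * binomialTerm j (suc b)
  binomialTerm-pascal j b with b <? j
  ... | yes b<j rewrite ∸-suc b<j = expand y z (choose j b) (choose j (suc b)) (y ^ (j ∸ suc b)) (z ^ b)
    where
    expand : ∀ y z c c' p q → (c + c') * (y * p) * (z * q) ≡ z * (c * (y * p) * q) + y * (c' * p * (z * q))
    expand = solve-∀
  ... | no b≮j rewrite choose-zero j (suc b) (s≤s (≮⇒≥ b≮j)) = expand y z (choose j b) (y ^ (j ∸ b)) (y ^ (j ∸ suc b)) (z ^ b)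
    where
    expand : ∀ y z c p p' q → (c + 0) * p * (z * q) ≡ z * (c * p * q) + y * (0 * p' * (z * q))
    expand = solve-∀

  binomial : ∀ j N → j < N → sumTo N (binomialTerm j) ≡ (y + z) ^ j
  binomial zero    (suc N) _ = trans (sumTo-first N (binomialTerm zero)) (cong (1 +_) (sumTo-zero N _ (λ k _ → refl)))
  binomial (suc j) (suc N) (s≤s j<N) = begin
    sumTo (suc N) (binomialTerm (suc j))
      ≡⟨ sumTo-first N (binomialTerm (suc j)) ⟩
    binomialTerm (suc j) 0 + sumTo N (λ b → binomialTerm (suc j) (suc b))
      ≡⟨ cong (binomialTerm (suc j) 0 +_) (trans (sum-cong (upTo N) _ _ (λ {b} _ → binomialTerm-pascal j b)) (sum-+ (upTo N) _ _)) ⟩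
    binomialTerm (suc j) 0 + (sumTo N (λ b → z * binomialTerm j b) + sumTo N (λ b → y * binomialTerm j (suc b)))
      ≡⟨ cong₂ (λ s t → binomialTerm (suc j) 0 + (s + t))
               (trans (sum-*ˡ (upTo N) (binomialTerm j) z) (cong (z *_) (binomial j N j<N))) (sum-*ˡ (upTo N) (λ b → binomialTerm j (suc b)) y) ⟩
    binomialTerm (suc j) 0 + (z * P + y * A)
      ≡⟨ cong (λ t → binomialTerm (suc j) 0 + (z * t + y * A)) P-split ⟩
    binomialTerm (suc j) 0 + (z * (y ^ j + A) + y * A)
      ≡⟨ collect y z (y ^ j) A ⟩
    (y + z) * (y ^ j + A)
      ≡⟨ cong ((y + z) *_) (sym P-split) ⟩
    (y + z) * P ∎
    where
    open ≡-Reasoning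
    P : ℕ
    P = (y + z) ^ j
    A : ℕ
    A = sumTo N (λ b → binomialTerm j (suc b))
    P-split : P ≡ y ^ j + A
    P-split = trans (sym (binomial j (suc N) (≤-trans j<N (n≤1+n N))))
                    (trans (sumTo-first N (binomialTerm j)) (cong (_+ A) (trans (*-identityʳ (1 * y ^ j)) (*-identityˡ (y ^ j)))))
    collect : ∀ y z t a → 1 * (y * t) * 1 + (z * (t + a) + y * a) ≡ (y + z) * (t + a)
    collect = solve-∀

-- First, lap + dasc + dp ≤ n:
-- the entries at which some statistic occurs are pairwise distinct values
-- in {1..n}, because the second copy of a value never starts such a window.

anyTest : Test
anyTest a b c = lapTest a b c ∨ dascTest a b c ∨ dpTest a b c

-- The three tests are mutually exclusive.
bit-anyTest : ∀ p x y → bit (lapTest p x y) + bit (dascTest p x y) + bit (dpTest p x y) ≡ bit (anyTest p x y)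
bit-anyTest p x y with p <ᵇ x in e₁ | x ≡ᵇ y in e₂ | x <ᵇ y in e₃ | x <ᵇ p in e₄
... | true  | true  | true  | _     = ⊥-elim (<-irrefl (≡ᵇ-sound {x} {y} e₂) (<ᵇ-sound {x} {y} e₃))
... | true  | _     | _     | true  = ⊥-elim (<-asym (<ᵇ-sound {p} {x} e₁) (<ᵇ-sound {x} {p} e₄))
... | true  | true  | false | false = refl
... | true  | false | true  | false = refl
... | true  | false | false | false = refl
... | false | true  | _     | true  = refl
... | false | false | _     | true  = refl
... | false | true  | _     | false = refl
... | false | false | _     | false = refl

windows-anyTest : ∀ p w → windows lapTest p w + windows dascTest p w + windows dpTest p w ≡ windows anyTest p w
windows-anyTest p []          = refl
windows-anyTest p (x ∷ [])    = refl
windows-anyTest p (x ∷ y ∷ r) =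
  trans (interchange (bit (lapTest p x y)) (bit (dascTest p x y)) (bit (dpTest p x y))
                     (windows lapTest x (y ∷ r)) (windows dascTest x (y ∷ r)) (windows dpTest x (y ∷ r)))
        (cong₂ _+_ (bit-anyTest p x y) (windows-anyTest x (y ∷ r)))
  where
  interchange : ∀ a b c d e f → (a + d) + (b + e) + (c + f) ≡ (a + b + c) + (d + e + f)
  interchange = solve-∀

consIf : Bool → ℕ → List ℕ → List ℕ
consIf true  x L = x ∷ L
consIf false x L = L

statEntries : ℕ → List ℕ → List ℕ
statEntries p []          = []
statEntries p (x ∷ [])    = []
statEntries p (x ∷ y ∷ r) = consIf (anyTest p x y) x (statEntries x (y ∷ r))

length-statEntries : ∀ p w → length (statEntries p w) ≡ windows anyTest p w
length-statEntries p []          = refl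
length-statEntries p (x ∷ [])    = refl
length-statEntries p (x ∷ y ∷ r) = trans (length-consIf (anyTest p x y)) (cong (bit (anyTest p x y) +_) (length-statEntries x (y ∷ r)))
  where
  length-consIf : ∀ c → length (consIf c x (statEntries x (y ∷ r))) ≡ bit c + length (statEntries x (y ∷ r))
  length-consIf true  = refl
  length-consIf false = refl

consIf-⊆ : ∀ {a} c x L → a ∈ consIf c x L → a ∈ x ∷ L
consIf-⊆ true  x L m = m
consIf-⊆ false x L m = there m

consIf-∉ : ∀ {a} c x L → (c ≡ true → a ≢ x) → a ∉ L → a ∉ consIf c x L
consIf-∉ true  x L h n (here e)  = h refl e
consIf-∉ true  x L h n (there m) = n m
consIf-∉ false x L h n m         = n m

statEntries-⊆ : ∀ {a} p w → a ∈ statEntries p w → a ∈ w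
statEntries-⊆ p (x ∷ y ∷ r) m = ∷-mono (consIf-⊆ (anyTest p x y) x (statEntries x (y ∷ r)) m) (statEntries-⊆ x (y ∷ r))
  where
  ∷-mono : ∀ {a L w} → a ∈ x ∷ L → (a ∈ L → a ∈ w) → a ∈ x ∷ w
  ∷-mono (here e)  f = here e
  ∷-mono (there m) f = there (f m)

-- A window (q, x, z') with q ≥ x satisfies no test unless x = z' is a
-- plateau, which the guard of x forbids.
no-window-after : ∀ x q z' r → x ≤ q → (x ∈ z' ∷ r → x < x) → anyTest q x z' ≡ true → ⊥
no-window-after x q z' r x≤q guard e
  rewrite <ᵇ-false {q} {x} (λ l → <-irrefl refl (<-≤-trans l x≤q)) with x <ᵇ q | x ≡ᵇ z' in e₃
... | true  | true  = <-irrefl refl (guard (subst (_∈ z' ∷ r) (sym (≡ᵇ-sound e₃)) (here refl)))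
... | true  | false with () ← e
... | false | true  with () ← e
... | false | false with () ← e

-- Past the window centred at z, the relevant previous entry for x is
-- either x itself or an entry z > x guarding a later copy of x.
∉-statEntries-tail : ∀ x z z' r → Guards x (z ∷ z' ∷ r) → (∀ q → x ≤ q → x ∉ statEntries q (z' ∷ r))
                   → x ∉ statEntries z (z' ∷ r)
∉-statEntries-tail x z z' r (guard , _) later with x ≟ z
... | yes refl = later x ≤-refl
... | no _ with x ∈? (z' ∷ r)
...   | yes x∈ = later z (<⇒≤ (guard x∈))
...   | no x∉  = λ m → x∉ (statEntries-⊆ z (z' ∷ r) m)

∉-statEntries : ∀ x q w → x ≤ q → Guards x w → x ∉ statEntries q w
∉-statEntries x q (z ∷ z' ∷ r) x≤q (guard , guards) =
  consIf-∉ (anyTest q z z') z (statEntries z (z' ∷ r)) (λ { e refl → no-window-after x q z' r x≤q guard e })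
    (∉-statEntries-tail x z z' r (guard , guards) (λ q' x≤q' → ∉-statEntries x q' (z' ∷ r) x≤q' guards))

statEntries-unique : ∀ p w → Stirling w → Unique (statEntries p w)
statEntries-unique p []          s       = []
statEntries-unique p (x ∷ [])    s       = []
statEntries-unique p (x ∷ y ∷ r) (g , s) =
  consIf-unique (anyTest p x y) (∉-statEntries x x (y ∷ r) ≤-refl g) (statEntries-unique x (y ∷ r) s)
  where
  consIf-unique : ∀ c {L} → x ∉ L → Unique L → Unique (consIf c x L)
  consIf-unique true  {L} x∉ u = All.tabulate (λ m e → x∉ (subst (_∈ L) (sym e) m)) ∷ u
  consIf-unique false     x∉ u = u

stats-bound : ∀ n σ → InQ n σ → lap σ + dasc σ + dp σ ≤ n
stats-bound n σ q = begin
  lap σ + dasc σ + dp σ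
    ≡⟨ cong₂ _+_ (cong₂ _+_ (countPos≡windows lapTest σ) (countPos≡windows dascTest σ)) (countPos≡windows dpTest σ) ⟩
  windows lapTest 0 σ + windows dascTest 0 σ + windows dpTest 0 σ
    ≡⟨ trans (windows-anyTest 0 σ) (sym (length-statEntries 0 σ)) ⟩
  length (statEntries 0 σ)
    ≤⟨ unique-⊆-length (statEntries 0 σ) (range1 n) (statEntries-unique 0 σ (InQ.stirling q))
         (λ m → All.lookup (InQ.range q) (statEntries-⊆ 0 σ m)) ⟩
  length (range1 n)
    ≡⟨ length-applyUpTo suc n ⟩
  n ∎
  where open ≤-Reasoning

-- Second, lap ≥ 1 for n ≥ 1: the two copies of the largest value n are
-- adjacent and preceded by a smaller entry, so they form a left
-- ascent-plateau.

max-plateau : ∀ m p w → p < m → All (_≤ m) w → Stirling w → occ m w ≡ 2 → 1 ≤ windows lapTest p w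
max-plateau m p []           p<m al s ()
max-plateau m p (z ∷ [])     p<m al s o with m ≡ᵇ z
max-plateau m p (z ∷ [])     p<m al s () | true
max-plateau m p (z ∷ [])     p<m al s () | false
max-plateau m p (z ∷ z' ∷ r) p<m (z≤m ∷ al) (g , s) o with z ≟ m
... | no z≢m = ≤-trans (max-plateau m z (z' ∷ r) (≤∧≢⇒< z≤m z≢m) al s o') (m≤n+m _ _)
  where
  o' : occ m (z' ∷ r) ≡ 2
  o' rewrite sym o | ≡ᵇ-false {m} {z} (λ e → z≢m (sym e)) = refl
... | yes refl with z' ≟ m
...   | yes refl rewrite <ᵇ-true p<m | ≡ᵇ-true {m} {m} refl = s≤s z≤n
...   | no z'≢m = ⊥-elim (<⇒≱ (proj₁ g (m∈r (occ-∈ m (z' ∷ r) occ≢0))) (All.head al))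
  where
  m∈r : m ∈ z' ∷ r → m ∈ r
  m∈r (here e) = ⊥-elim (z'≢m (sym e))
  m∈r (there k) = k
  occ≢0 : occ m (z' ∷ r) ≢ 0
  occ≢0 occ≡0 with () ← trans (sym o) (trans (occ-self m (z' ∷ r)) (cong suc occ≡0))

lap-pos : ∀ n σ → 1 ≤ n → InQ n σ → 1 ≤ lap σ
lap-pos (suc k) σ _ q = subst (1 ≤_) (sym (countPos≡windows lapTest σ))
  (max-plateau (suc k) 0 σ (s≤s z≤n) (All.map ∈-range1-≤ (InQ.range q)) (InQ.stirling q)
    (occ-twice q (∈-applyUpTo⁺ suc (n<1+n k))))

class-empty : ∀ n i j b → (∀ σ → InClass n i j b σ → ⊥) → K n i j b ≡ 0
class-empty n i j b none with class n i j b in e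
... | []    = refl
... | σ ∷ _ = ⊥-elim (none σ (class-sound n i j b σ (subst (σ ∈_) (sym e) (here refl))))

class-size : ∀ n i j b → K n i j b ≡ choose j b * K n i j 0
class-size n i j zero    = sym (+-identityʳ _)
class-size n i j (suc b) = *-cancelʳ-≡ (K n i j (suc b)) (choose j (suc b) * K₀) (suc b) (begin
  K n i j (suc b) * suc b            ≡⟨ class-recurrence n i j b ⟩
  K n i j b * (j ∸ b)                ≡⟨ cong (_* (j ∸ b)) (class-size n i j b) ⟩
  choose j b * K₀ * (j ∸ b)          ≡⟨ reorder (choose j b) K₀ (j ∸ b) ⟩
  ((j ∸ b) * choose j b) * K₀        ≡⟨ cong (_* K₀) (sym (choose-recurrence j b)) ⟩
  (suc b * choose j (suc b)) * K₀    ≡⟨ reorder′ (suc b) (choose j (suc b)) K₀ ⟩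
  choose j (suc b) * K₀ * suc b      ∎)
  where
  open ≡-Reasoning
  K₀ : ℕ
  K₀ = K n i j 0
  reorder : ∀ c k d → c * k * d ≡ (d * c) * k
  reorder = solve-∀
  reorder′ : ∀ s c k → (s * c) * k ≡ c * k * s
  reorder′ = solve-∀

-- γ is the size of the class b = 0 (dp = 0 forces dasc + dp = dasc).
γ≡class₀ : ∀ n i j → γ n i j ≡ K n i j 0
γ≡class₀ n i j = cong length (filter-cong _ _ (Q n) same-test)
  where
  same-test : ∀ σ → ((lap σ ≡ᵇ i) ∧ (dasc σ ≡ᵇ j) ∧ (dp σ ≡ᵇ 0)) ≡ classTest i j 0 σ
  same-test σ with dp σ
  ... | zero  rewrite +-identityʳ (dasc σ) = refl
  ... | suc k rewrite ∧-zeroʳ (dasc σ ≡ᵇ j) | ∧-zeroʳ ((dasc σ + suc k) ≡ᵇ j) = refl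

γ-lap-zero : ∀ n j → 1 ≤ n → γ n 0 j ≡ 0
γ-lap-zero n j n≥1 = trans (γ≡class₀ n 0 j)
  (class-empty n 0 j 0 (λ σ c → <-irrefl (sym (InClass.lap≡ c)) (lap-pos n σ n≥1 (InClass.inQ c))))

γ-too-large : ∀ n i j → n < i + j → γ n i j ≡ 0
γ-too-large n i j n<i+j = trans (γ≡class₀ n i j) (class-empty n i j 0 (λ σ c → <⇒≱ n<i+j (bound σ c)))
  where
  bound : ∀ σ → InClass n i j 0 σ → i + j ≤ n
  bound σ c = subst₂ (λ a b → a + b ≤ n) (InClass.lap≡ c) (InClass.stat≡ c)
    (subst (_≤ n) (+-assoc (lap σ) (dasc σ) (dp σ)) (stats-bound n σ (InClass.inQ c)))

module _ (n x y z : ℕ) where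

  private
    N : ℕ
    N = suc n

  weight : List ℕ → ℕ
  weight σ = x ^ lap σ * y ^ dasc σ * z ^ dp σ

  keys-bound : ∀ {σ} → σ ∈ Q n → lap σ < N × dasc σ + dp σ < N × dp σ < N
  keys-bound {σ} m =
      s≤s (≤-trans (m≤m+n (lap σ) _) total)
    , s≤s (≤-trans (m≤n+m _ (lap σ)) total)
    , s≤s (≤-trans (m≤n+m (dp σ) _) (stats-bound n σ (Q-sound n σ m)))
    where
    total : lap σ + (dasc σ + dp σ) ≤ n
    total = subst (_≤ n) (+-assoc (lap σ) (dasc σ) (dp σ)) (stats-bound n σ (Q-sound n σ m))

  lhs-by-classes : lhs n x y z ≡ sumTo N (λ i → sumTo N (λ j → sumTo N (λ b → sum (map weight (class n i j b)))))
  lhs-by-classes =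
    trans (sum-partition (Q n) lap weight N (λ m → proj₁ (keys-bound m)))
          (sum-cong (upTo N) _ _ λ {i} _ →
    trans (sum-partition (byLap i) stat weight N (λ m → proj₁ (proj₂ (keys-bound (⊆Q₁ m)))))
          (sum-cong (upTo N) _ _ λ {j} _ →
    trans (sum-partition (byStat i j) dp weight N (λ m → proj₂ (proj₂ (keys-bound (⊆Q₁ (⊆filter (byLap i) m))))))
          (sum-cong (upTo N) _ _ λ {b} _ → cong (λ L → sum (map weight L)) (fuse i j b))))
    where
    stat : List ℕ → ℕ
    stat σ = dasc σ + dp σ
    key : (List ℕ → ℕ) → ℕ → List ℕ → Bool
    key f k σ = f σ ≡ᵇ k
    byLap : ℕ → List (List ℕ)
    byLap i = filter (λ σ → T? (key lap i σ)) (Q n)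
    byStat : ℕ → ℕ → List (List ℕ)
    byStat i j = filter (λ σ → T? (key stat j σ)) (byLap i)
    ⊆filter : ∀ {p : List ℕ → Bool} L {σ} → σ ∈ filter (λ σ → T? (p σ)) L → σ ∈ L
    ⊆filter {p} L m = proj₁ (∈-filter⁻ (λ σ → T? (p σ)) {xs = L} m)
    ⊆Q₁ : ∀ {i σ} → σ ∈ byLap i → σ ∈ Q n
    ⊆Q₁ = ⊆filter (Q n)
    fuse : ∀ i j b → filter (λ σ → T? (key dp b σ)) (byStat i j) ≡ class n i j b
    fuse i j b = begin
      filter (λ σ → T? (key dp b σ)) (byStat i j)
        ≡⟨ cong (filter (λ σ → T? (key dp b σ))) (filter-filter (key lap i) (key stat j) (Q n)) ⟩
      filter (λ σ → T? (key dp b σ)) (filter (λ σ → T? (key lap i σ ∧ key stat j σ)) (Q n))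
        ≡⟨ filter-filter (λ σ → key lap i σ ∧ key stat j σ) (key dp b) (Q n) ⟩
      filter (λ σ → T? ((key lap i σ ∧ key stat j σ) ∧ key dp b σ)) (Q n)
        ≡⟨ filter-cong _ _ (Q n) (λ σ → ∧-assoc (key lap i σ) (key stat j σ) (key dp b σ)) ⟩
      class n i j b ∎
      where open ≡-Reasoning

  class-sum : ∀ i j b → sum (map weight (class n i j b)) ≡ γ n i j * x ^ i * binomialTerm y z j b
  class-sum i j b = begin
    sum (map weight (class n i j b))                      ≡⟨ sum-const (class n i j b) weight _ constant ⟩
    K n i j b * (x ^ i * y ^ (j ∸ b) * z ^ b)             ≡⟨ cong (_* (x ^ i * y ^ (j ∸ b) * z ^ b)) (class-size n i j b) ⟩
    choose j b * K n i j 0 * (x ^ i * y ^ (j ∸ b) * z ^ b) ≡⟨ cong (λ g → choose j b * g * (x ^ i * y ^ (j ∸ b) * z ^ b)) (sym (γ≡class₀ n i j)) ⟩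
    choose j b * γ n i j * (x ^ i * y ^ (j ∸ b) * z ^ b)  ≡⟨ regroup (choose j b) (γ n i j) (x ^ i) (y ^ (j ∸ b)) (z ^ b) ⟩
    γ n i j * x ^ i * binomialTerm y z j b                ∎
    where
    open ≡-Reasoning
    constant : ∀ {σ} → σ ∈ class n i j b → weight σ ≡ x ^ i * y ^ (j ∸ b) * z ^ b
    constant {σ} m = cong₃ (λ l a d → x ^ l * y ^ a * z ^ d) (InClass.lap≡ c) dasc≡ (InClass.dp≡ c)
      where
      c : InClass n i j b σ
      c = class-sound n i j b σ m
      dasc≡ : dasc σ ≡ j ∸ b
      dasc≡ = trans (sym (m+n∸n≡m (dasc σ) (dp σ))) (cong₂ _∸_ (InClass.stat≡ c) (InClass.dp≡ c))
    regroup : ∀ c g p q r → c * g * (p * q * r) ≡ g * p * (c * q * r)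
    regroup = solve-∀

  lhs-γ : lhs n x y z ≡ sumTo N (λ i → sumTo N (λ j → γ n i j * x ^ i * (y + z) ^ j))
  lhs-γ = trans lhs-by-classes (sum-cong (upTo N) _ _ λ {i} _ → sum-cong (upTo N) _ _ λ {j} j∈ → begin
    sumTo N (λ b → sum (map weight (class n i j b)))          ≡⟨ sum-cong (upTo N) _ _ (λ {b} _ → class-sum i j b) ⟩
    sumTo N (λ b → γ n i j * x ^ i * binomialTerm y z j b)    ≡⟨ sum-*ˡ (upTo N) (binomialTerm y z j) (γ n i j * x ^ i) ⟩
    γ n i j * x ^ i * sumTo N (binomialTerm y z j)            ≡⟨ cong (γ n i j * x ^ i *_) (binomial y z j N (∈-upTo⁻ j∈)) ⟩
    γ n i j * x ^ i * (y + z) ^ j                             ∎)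
    where open ≡-Reasoning

  -- Dropping the vanishing terms i = 0 and j = n.
  γ-sum-range : 1 ≤ n → sumTo N (λ i → sumTo N (λ j → γ n i j * x ^ i * (y + z) ^ j)) ≡ rhs n x y z
  γ-sum-range n≥1 = cong₂ _+_ lap-zero-terms (sum-cong (range1 n) _ _ (λ {i} i∈ → drop-last i (∈-range1-pos i∈)))
    where
    term : ℕ → ℕ → ℕ
    term i j = γ n i j * x ^ i * (y + z) ^ j
    lap-zero-terms : sumTo N (term 0) ≡ 0
    lap-zero-terms = sumTo-zero N _ (λ j _ → cong (λ g → g * 1 * (y + z) ^ j) (γ-lap-zero n j n≥1))
    drop-last : ∀ i → 1 ≤ i → sumTo N (term i) ≡ sumTo n (term i)
    drop-last i i≥1 = begin
      sumTo N (term i)               ≡⟨ sumTo-last n (term i) ⟩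
      sumTo n (term i) + term i n    ≡⟨ cong (λ g → sumTo n (term i) + g * x ^ i * (y + z) ^ n) (γ-too-large n i n (+-monoˡ-≤ n i≥1)) ⟩
      sumTo n (term i) + 0           ≡⟨ +-identityʳ _ ⟩
      sumTo n (term i)               ∎
      where open ≡-Reasoning

mainTheorem3 : (n : ℕ) → n ≥ 1 → (x y z : ℕ) → lhs n x y z ≡ rhs n x y z
mainTheorem3 n n≥1 x y z = trans (lhs-γ n x y z) (γ-sum-range n x y z n≥1)
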